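{- Let $k\ge 1$ and for $0\le a\le k$ let $\hat a$ denote the class of $[a]=\{1,\dots,a\}$ in $\langle P[k]\rangle/S_k$ (so $\hat 0,\dots,\hat k$ form a basis). Then for $0\le a,b\le k$: (1) with $m=\min(k-a,b)$, $\hat a\cup\hat b=\frac{1}{\binom{k}{b}}\sum_{l=0}^{m}\binom{a}{b-l}\binom{k-a}{l}\,\widehat{a+l}$; (2) with $m=\min(a,b)$, $\hat a\cap\hat b=\frac{1}{\binom{k}{b}}\sum_{l=0}^{m}\binom{a}{l}\binom{k-a}{b-l}\,\hat l$; (3) $(\hat a)^c=\widehat{k-a}$.
   Context: $\mathbb{K}$ is a field of characteristic zero, $[k]=\{1,\dots,k\}$, $\langle P[k]\rangle$ is the $\mathbb{K}$-vector space with basis the subsets of $[k]$, with union and intersection the bilinear extensions of the set operations and complement the linear extension of $a\mapsto[k]\setminus a$. $S_k$ acts on $\langle P[k]\rangle$ by $\sigma\cdot c=\sigma(c)$. The coinvariant space $\langle P[k]\rangle/S_k$ (quotient by the span of $\sigma v-v$) carries the induced operations $\bar u\cup\bar v=\frac{1}{k!}\sum_{\sigma\in S_k}\overline{u\cup\sigma v}$, $\bar u\cap\bar v=\frac{1}{k!}\sum_{\sigma\in S_k}\overline{u\cap\sigma v}$, and $\bar u^c=\overline{u^c}$. Binomial coefficients $\binom{p}{q}$ are $0$ when $q<0$ or $q>p$. -}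

module Defs where

open import Level using (Level; _⊔_) renaming (suc to lsuc)
open import Algebra.Bundles using (CommutativeRing)
open import Data.Nat using (ℕ; zero; suc; _∸_; _<ᵇ_; _⊓_)
import Data.Nat
open import Data.Nat using (_!)
open import Data.Nat.Combinatorics using (_C_)
open import Data.Bool using (Bool; true; false; _∧_; _∨_)
open import Data.Fin using (Fin; toℕ)
open import Data.Fin.Subset using (Subset; _∪_; _∩_; ∁)
open import Data.Vec using (Vec; []; _∷_; tabulate; lookup; toList)
import Data.Vec.Properties as VecP
open import Data.List using (List; []; _∷_; [_]; map; _++_; foldr; filter; upTo; allFin)
open import Data.List.Relation.Unary.Unique.Propositional using (Unique)
import Data.List.Relation.Unary.Unique.DecPropositional as UDec
open import Data.Product using (Σ; ∃; _×_; _,_)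
open import Relation.Nullary using (¬_; Dec; yes; no)
open import Relation.Nullary.Decidable using (⌊_⌋)
open import Relation.Binary.PropositionalEquality using (_≡_)
open import Function.Definitions using (Injective)
import Data.Fin.Properties as FinP
import Data.Bool.Properties as BoolP

castR : ∀ {c ℓ} (R : CommutativeRing c ℓ) → ℕ → CommutativeRing.Carrier R
castR R zero    = CommutativeRing.0# R
castR R (suc n) = CommutativeRing._+_ R (CommutativeRing.1# R) (castR R n)

record CharZeroField (c ℓ : Level) : Set (lsuc (c ⊔ ℓ)) where
  field
    ring     : CommutativeRing c ℓ
    0≉1      : ¬ (CommutativeRing._≈_ ring (CommutativeRing.0# ring) (CommutativeRing.1# ring))
    _⁻¹      : (x : CommutativeRing.Carrier ring) →
               ¬ (CommutativeRing._≈_ ring x (CommutativeRing.0# ring)) → CommutativeRing.Carrier ring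
    inverse  : ∀ x (p : ¬ (CommutativeRing._≈_ ring x (CommutativeRing.0# ring))) →
               CommutativeRing._≈_ ring (CommutativeRing._*_ ring x (_⁻¹ x p)) (CommutativeRing.1# ring)
    charZero : ∀ n → ¬ (CommutativeRing._≈_ ring (castR ring (suc n)) (CommutativeRing.0# ring))
  open CommutativeRing ring public hiding (ring)
  cast : ℕ → Carrier
  cast = castR ring
  -- 1/n for n ≥ 1 (and, by convention, 0 for n = 0; only used with n ≥ 1)
  recip : ℕ → Carrier
  recip zero    = 0#
  recip (suc n) = _⁻¹ (cast (suc n)) (charZero n)

allSubsets : (n : ℕ) → List (Subset n)
allSubsets zero    = [ [] ]
allSubsets (suc n) = map (true ∷_) (allSubsets n) ++ map (false ∷_) (allSubsets n)

allVecs : (k n : ℕ) → List (Vec (Fin k) n)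
allVecs k zero    = [ [] ]
allVecs k (suc n) = foldr (λ i acc → map (i ∷_) (allVecs k n) ++ acc) [] (allFin k)

allPerms : (k : ℕ) → List (Fin k → Fin k)
allPerms k = map lookup (filter (λ v → UDec.unique? FinP._≟_ (toList v)) (allVecs k k))

module Coinv {c ℓ : Level} (F : CharZeroField c ℓ) (k : ℕ) where
  open CharZeroField F

  -- ⟨P[k]⟩ : a vector is its family of coefficients on the basis of subsets
  V : Set c
  V = Subset k → Carrier

  sumL : {A : Set} → List A → (A → Carrier) → Carrier
  sumL xs f = foldr (λ x r → f x + r) 0# xs

  sumL′ : {A : Set c} → List A → (A → Carrier) → Carrier
  sumL′ xs f = foldr (λ x r → f x + r) 0# xs

  ind : {P : Set} → Dec P → Carrier
  ind (yes _) = 1#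
  ind (no _)  = 0#

  _≟S_ : (a b : Subset k) → Dec (a ≡ b)
  _≟S_ = VecP.≡-dec BoolP._≟_

  basis : Subset k → V
  basis s d = ind (d ≟S s)

  image : (Fin k → Fin k) → Subset k → Subset k
  image σ c = tabulate (λ j → foldr _∨_ false
                 (map (λ i → lookup c i ∧ ⌊ σ i FinP.≟ j ⌋) (allFin k)))

  act : (Fin k → Fin k) → V → V
  act σ u d = sumL (allSubsets k) (λ c → ind (image σ c ≟S d) * u c)

  _∪V_ : V → V → V
  (u ∪V v) d = sumL (allSubsets k) (λ a → sumL (allSubsets k) (λ b →
                 ind ((a ∪ b) ≟S d) * (u a * v b)))

  _∩V_ : V → V → V
  (u ∩V v) d = sumL (allSubsets k) (λ a → sumL (allSubsets k) (λ b →
                 ind ((a ∩ b) ≟S d) * (u a * v b)))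

  complV : V → V
  complV u d = u (∁ d)

  Perm : Set
  Perm = Σ (Fin k → Fin k) (Injective _≡_ _≡_)

  InW : V → Set (c ⊔ ℓ)
  InW w = ∃ λ (L : List (Carrier × Perm × V)) → ∀ d →
            w d ≈ sumL′ L (λ { (x , (σ , _) , v) → x * (act σ v d - v d) })

  -- equality in the coinvariant space ⟨P[k]⟩/S_k of the classes of u and v
  _∼_ : V → V → Set (c ⊔ ℓ)
  u ∼ v = InW (λ d → u d - v d)

  -- representatives of the induced operations on coinvariants:
  -- ū ∪ v̄ = (1/k!) Σ_σ (u ∪ σ v),  ū ∩ v̄ = (1/k!) Σ_σ (u ∩ σ v),  ū^c = u^c
  cupC : V → V → V
  cupC u v d = recip (k !) * sumL (allPerms k) (λ σ → (u ∪V act σ v) d)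

  capC : V → V → V
  capC u v d = recip (k !) * sumL (allPerms k) (λ σ → (u ∩V act σ v) d)

  -- [a] = {1,…,a}  (0-indexed: {0,…,a-1} ⊆ Fin k)
  seg : ℕ → Subset k
  seg a = tabulate (λ i → toℕ i <ᵇ a)

  hat : ℕ → V
  hat a = basis (seg a)

  rhsCup : ℕ → ℕ → V
  rhsCup a b d = recip (k C b) * sumL (upTo (suc ((k ∸ a) ⊓ b)))
                   (λ l → cast ((a C (b ∸ l)) Data.Nat.* ((k ∸ a) C l)) * hat (a Data.Nat.+ l) d)

  rhsCap : ℕ → ℕ → V
  rhsCap a b d = recip (k C b) * sumL (upTo (suc (a ⊓ b)))
                   (λ l → cast ((a C l) Data.Nat.* ((k ∸ a) C (b ∸ l))) * hat l d)

-- Every subset d of [k] is carried onto the segment [∣d∣] by a permutation, so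
-- w − Σⱼ (levelSum j w)·[j] lies in the span of the σv − v, where levelSum j w sums the
-- coefficients of w on the j-element subsets. Hence vectors with equal level sums have
-- equal classes, and it suffices to compare level sums. The j-th level sum of
-- (1/k!) Σ_σ [a] ∪ σ[b] is the proportion of permutations σ with ∣[a] ∪ σ[b]∣ = j.
-- Listing σ by its values, the σ that put exactly l elements of σ[b] outside [a] number
-- b! (k−b)! C(a, b−l) C(k−a, l), by choosing the first value and recursing on the rest with
-- the used values removed; as k! = C(k, b) b! (k−b)!, this gives (1). For (2) the same count
-- is read through ∣[a] ∩ σ[b]∣, and (3) holds because ∁[a] has k − a elements.

module Submission where

open import Defs
open import Level using (Level)
open import Algebra.Bundles using (CommutativeRing; CommutativeMonoid)
open import Data.Bool using (Bool; true; false; _∧_; _∨_; not)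
import Data.Bool.Properties as Boolₚ
open import Data.Fin using (Fin; zero; suc; toℕ; punchIn; fromℕ<)
import Data.Fin.Properties as Finₚ
open import Data.Fin.Permutation using (Permutation′; insert; insert-punchIn; _⟨$⟩ʳ_; _⟨$⟩ˡ_; inverseˡ; inverseʳ)
import Data.Fin.Permutation as Permutation
open import Data.Fin.Subset using (Subset; ∣_∣; _∪_; _∩_; ∁)
open import Data.Fin.Subset.Properties using (∣p∣≤n; ∣p∩q∣≤∣p∣; ∣∁p∣≡n∸∣p∣)
open import Data.List using (List; []; _∷_; _++_; map; filter; foldr; upTo)
import Data.List as List
import Data.List.Properties as Listₚ
open import Data.List.Membership.Propositional using (_∈_)
open import Data.List.Membership.Propositional.Properties using (∈-map⁺; ∈-map⁻; ∈-++⁺ˡ; ∈-++⁺ʳ; ∈-upTo⁺; ∈-upTo⁻)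
open import Data.List.Relation.Unary.All using (all?)
import Data.List.Relation.Unary.All as All
open import Data.List.Relation.Unary.AllPairs using (_∷_)
import Data.List.Relation.Unary.AllPairs as AllPairs
open import Data.List.Relation.Unary.Any using (here; there)
open import Data.List.Relation.Unary.Unique.Propositional using (Unique)
import Data.List.Relation.Unary.Unique.Propositional.Properties as Uniqueₚ
import Data.List.Relation.Unary.Unique.DecPropositional as UniqueDec
open import Data.Nat using (ℕ; zero; suc; _∸_; _≤_; _<ᵇ_; z≤n; s≤s; _!; _⊓_; NonZero)
import Data.Nat as ℕ
import Data.Nat.Properties as ℕₚ
open import Data.Nat.Combinatorics using (_C_; nC1≡n; nCk+nC[k+1]≡[n+1]C[k+1]; k![n∸k]!∣n!; nCk≡n!/k![n-k]!)
open import Data.Nat.DivMod using (m/n*n≡m)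
open import Data.Nat.Tactic.RingSolver using (solve-∀)
open import Data.Product using (_×_; _,_; proj₁; proj₂)
open import Data.Vec using (Vec; []; _∷_; lookup; toList; zipWith)
import Data.Vec.Properties as Vecₚ
open import Function using (_∘_)
open import Relation.Binary.Definitions using (DecidableEquality)
open import Relation.Binary.PropositionalEquality as ≡ using (_≡_; _≢_)
open import Relation.Nullary using (Dec; yes; no; does; ¬_; ¬?)
open import Relation.Nullary.Decidable using (⌊_⌋; dec-true; dec-false; isYes≗does)
open import Relation.Unary using (Decidable)

-- ℕ arithmetic is opened only in this block, so that _+_ and _*_ elsewhere are the ring operations.
module _ where
  open import Data.Nat using (_+_; _*_)
  open ≡ using (refl; sym; trans; cong; cong₂; subst; module ≡-Reasoning)
  open ℕₚ using (_!*_!≢0)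
  open import Algebra.Lattice.Properties.BooleanAlgebra Boolₚ.∨-∧-booleanAlgebra using (deMorgan₂)
  open import Algebra.Properties.CommutativeSemigroup (CommutativeMonoid.commutativeSemigroup Boolₚ.∧-commutativeMonoid)
    using () renaming (interchange to ∧-interchange)

  boolToℕ : Bool → ℕ
  boolToℕ false = 0
  boolToℕ true  = 1

  card : ∀ {n} → (Fin n → Bool) → ℕ
  card {zero}  p = 0
  card {suc n} p = boolToℕ (p zero) + card (p ∘ suc)

  anyFin : ∀ {n} → (Fin n → Bool) → Bool
  anyFin {zero}  p = false
  anyFin {suc n} p = p zero ∨ anyFin (p ∘ suc)

  below : ∀ {n} → ℕ → Fin n → Bool
  below m i = toℕ i <ᵇ m

  card-cong : ∀ {n} {p q : Fin n → Bool} → (∀ i → p i ≡ q i) → card p ≡ card q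
  card-cong {zero}  p≗q = refl
  card-cong {suc n} p≗q = cong₂ _+_ (cong boolToℕ (p≗q zero)) (card-cong (p≗q ∘ suc))

  card-false : ∀ {n} {p : Fin n → Bool} → (∀ i → p i ≡ false) → card p ≡ 0
  card-false {zero}  p≗false = refl
  card-false {suc n} p≗false rewrite p≗false zero = card-false (p≗false ∘ suc)

  card-true : ∀ n → card {n} (λ _ → true) ≡ n
  card-true zero    = refl
  card-true (suc n) = cong suc (card-true n)

  card-below : ∀ {n} m → m ≤ n → card {n} (below m) ≡ m
  card-below {zero}  zero    z≤n       = refl
  card-below {suc n} zero    _         = card-false {suc n} (λ _ → refl)
  card-below {suc n} (suc m) (s≤s m≤n) = cong suc (card-below m m≤n)

  card-+ : ∀ {n} {p q r : Fin n → Bool} → (∀ i → boolToℕ (p i) + boolToℕ (q i) ≡ boolToℕ (r i)) →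
           card p + card q ≡ card r
  card-+ {zero}          pqr = refl
  card-+ {suc n} {p} {q} pqr = begin
    (boolToℕ (p zero) + card (p ∘ suc)) + (boolToℕ (q zero) + card (q ∘ suc))
      ≡⟨ interchange (boolToℕ (p zero)) _ _ _ ⟩
    (boolToℕ (p zero) + boolToℕ (q zero)) + (card (p ∘ suc) + card (q ∘ suc))
      ≡⟨ cong₂ _+_ (pqr zero) (card-+ (pqr ∘ suc)) ⟩
    _ ∎
    where
    open ≡-Reasoning
    interchange : ∀ a b c d → (a + b) + (c + d) ≡ (a + c) + (b + d)
    interchange = solve-∀

  card-not : ∀ {n} (p : Fin n → Bool) → card (not ∘ p) ≡ n ∸ card p
  card-not {n} p = trans (sym (ℕₚ.m+n∸m≡n (card p) _)) (cong (_∸ card p) (trans (card-+ split) (card-true n)))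
    where
    split : ∀ i → boolToℕ (p i) + boolToℕ (not (p i)) ≡ boolToℕ true
    split i with p i
    ... | true  = refl
    ... | false = refl

  card-∨ : ∀ {n} (p q : Fin n → Bool) → card (λ i → p i ∨ q i) ≡ card p + card (λ i → not (p i) ∧ q i)
  card-∨ p q = sym (card-+ split)
    where
    split : ∀ i → boolToℕ (p i) + boolToℕ (not (p i) ∧ q i) ≡ boolToℕ (p i ∨ q i)
    split i with p i
    ... | true  = refl
    ... | false = refl

  card-insert : ∀ {n} (p q : Fin n → Bool) x → (∀ i → i ≢ x → p i ≡ q i) → q x ≡ false →
                card p ≡ card q + boolToℕ (p x)
  card-insert {suc n} p q zero p≗q q0≡false = begin
    boolToℕ (p zero) + card (p ∘ suc)                    ≡⟨ cong (boolToℕ (p zero) +_) (card-cong (λ i → p≗q (suc i) λ ())) ⟩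
    boolToℕ (p zero) + card (q ∘ suc)                    ≡⟨ ℕₚ.+-comm (boolToℕ (p zero)) _ ⟩
    card (q ∘ suc) + boolToℕ (p zero)                    ≡⟨ cong (λ t → boolToℕ t + card (q ∘ suc) + boolToℕ (p zero)) q0≡false ⟨
    boolToℕ (q zero) + card (q ∘ suc) + boolToℕ (p zero) ∎
    where open ≡-Reasoning
  card-insert {suc n} p q (suc x) p≗q qx≡false = begin
    boolToℕ (p zero) + card (p ∘ suc)
      ≡⟨ cong₂ _+_ (cong boolToℕ (p≗q zero λ ()))
                   (card-insert (p ∘ suc) (q ∘ suc) x (λ i i≢x → p≗q (suc i) (i≢x ∘ Finₚ.suc-injective)) qx≡false) ⟩
    boolToℕ (q zero) + (card (q ∘ suc) + boolToℕ (p (suc x)))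
      ≡⟨ ℕₚ.+-assoc (boolToℕ (q zero)) _ _ ⟨
    boolToℕ (q zero) + card (q ∘ suc) + boolToℕ (p (suc x)) ∎
    where open ≡-Reasoning

  anyFin-cong : ∀ {n} {p q : Fin n → Bool} → (∀ i → p i ≡ q i) → anyFin p ≡ anyFin q
  anyFin-cong {zero}  p≗q = refl
  anyFin-cong {suc n} p≗q = cong₂ _∨_ (p≗q zero) (anyFin-cong (p≗q ∘ suc))

  anyFin-false : ∀ {n} {p : Fin n → Bool} → (∀ i → p i ≡ false) → anyFin p ≡ false
  anyFin-false {zero}  p≗false = refl
  anyFin-false {suc n} p≗false rewrite p≗false zero = anyFin-false (p≗false ∘ suc)

  anyFin-unique : ∀ {n} (p : Fin n → Bool) x → (∀ i → i ≢ x → p i ≡ false) → anyFin p ≡ p x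
  anyFin-unique {suc n} p zero p≗false
    rewrite anyFin-false {p = p ∘ suc} (λ i → p≗false (suc i) λ ()) = Boolₚ.∨-identityʳ (p zero)
  anyFin-unique {suc n} p (suc x) p≗false
    rewrite p≗false zero (λ ()) = anyFin-unique (p ∘ suc) x (λ i i≢x → p≗false (suc i) (i≢x ∘ Finₚ.suc-injective))

  [n+1]*nCk≡[k+1]*[n+1]C[k+1] : ∀ n k → suc n * (n C k) ≡ suc k * (suc n C suc k)
  [n+1]*nCk≡[k+1]*[n+1]C[k+1] n       zero    = trans (ℕₚ.*-identityʳ (suc n)) (sym (trans (ℕₚ.*-identityˡ _) (nC1≡n (suc n))))
  [n+1]*nCk≡[k+1]*[n+1]C[k+1] zero    (suc k) = sym (ℕₚ.*-zeroʳ (suc (suc k)))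
  [n+1]*nCk≡[k+1]*[n+1]C[k+1] (suc n) (suc k) = begin
    suc (suc n) * (suc n C suc k)
      ≡⟨ cong (suc (suc n) *_) (pascal n k) ⟨
    suc (suc n) * (n C k + n C suc k)
      ≡⟨ expand (suc n) (n C k) (n C suc k) ⟩
    (suc n * (n C k) + suc n * (n C suc k)) + (n C k + n C suc k)
      ≡⟨ cong₂ (λ u v → u + v + (n C k + n C suc k)) ([n+1]*nCk≡[k+1]*[n+1]C[k+1] n k) ([n+1]*nCk≡[k+1]*[n+1]C[k+1] n (suc k)) ⟩
    (suc k * B₁ + suc (suc k) * B₂) + (n C k + n C suc k)
      ≡⟨ cong (suc k * B₁ + suc (suc k) * B₂ +_) (pascal n k) ⟩
    (suc k * B₁ + suc (suc k) * B₂) + B₁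
      ≡⟨ collect (suc k) B₁ B₂ ⟩
    suc (suc k) * (B₁ + B₂)
      ≡⟨ cong (suc (suc k) *_) (pascal (suc n) (suc k)) ⟩
    suc (suc k) * (suc (suc n) C suc (suc k)) ∎
    where
    open ≡-Reasoning
    pascal = nCk+nC[k+1]≡[n+1]C[k+1]
    B₁ = suc n C suc k
    B₂ = suc n C suc (suc k)
    expand : ∀ m x y → suc m * (x + y) ≡ (m * x + m * y) + (x + y)
    expand = solve-∀
    collect : ∀ m x y → (m * x + suc m * y) + x ≡ suc m * (x + y)
    collect = solve-∀

  n*[n∸1]Ck≡[k+1]*nC[k+1] : ∀ n k → n * ((n ∸ 1) C k) ≡ suc k * (n C suc k)
  n*[n∸1]Ck≡[k+1]*nC[k+1] zero    k = sym (ℕₚ.*-zeroʳ (suc k))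
  n*[n∸1]Ck≡[k+1]*nC[k+1] (suc n) k = [n+1]*nCk≡[k+1]*[n+1]C[k+1] n k

  nCk*[k!*[n∸k]!]≡n! : ∀ {n k} → k ≤ n → (n C k) * (k ! * (n ∸ k) !) ≡ n !
  nCk*[k!*[n∸k]!]≡n! {n} {k} k≤n = trans (cong (_* (k ! * (n ∸ k) !)) (nCk≡n!/k![n-k]! k≤n))
    (m/n*n≡m {{k !* (n ∸ k) !≢0}} (k![n∸k]!∣n! k≤n))

  -- The binomial factors of the count that remains after a first entry inside (resp. outside) P.
  inStep outStep : ℕ → ℕ → ℕ → ℕ → ℕ
  inStep  α β zero    s       = 0
  inStep  α β (suc r) s       = ((α ∸ 1) C r) * (β C s)
  outStep α β r       zero    = 0
  outStep α β r       (suc s) = (α C r) * ((β ∸ 1) C s)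

  α*inStep : ∀ α β r s → α * inStep α β r s ≡ r * ((α C r) * (β C s))
  α*inStep α β zero    s = ℕₚ.*-zeroʳ α
  α*inStep α β (suc r) s = begin
    α * (((α ∸ 1) C r) * (β C s))   ≡⟨ ℕₚ.*-assoc α ((α ∸ 1) C r) (β C s) ⟨
    (α * ((α ∸ 1) C r)) * (β C s)   ≡⟨ cong (_* (β C s)) (n*[n∸1]Ck≡[k+1]*nC[k+1] α r) ⟩
    (suc r * (α C suc r)) * (β C s) ≡⟨ ℕₚ.*-assoc (suc r) (α C suc r) (β C s) ⟩
    suc r * ((α C suc r) * (β C s)) ∎
    where open ≡-Reasoning

  β*outStep : ∀ α β r s → β * outStep α β r s ≡ s * ((α C r) * (β C s))
  β*outStep α β r zero    = ℕₚ.*-zeroʳ β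
  β*outStep α β r (suc s) = begin
    β * ((α C r) * ((β ∸ 1) C s))   ≡⟨ x∙yz≈y∙xz β (α C r) _ ⟩
    (α C r) * (β * ((β ∸ 1) C s))   ≡⟨ cong ((α C r) *_) (n*[n∸1]Ck≡[k+1]*nC[k+1] β s) ⟩
    (α C r) * (suc s * (β C suc s)) ≡⟨ x∙yz≈y∙xz (α C r) (suc s) _ ⟩
    suc s * ((α C r) * (β C suc s)) ∎
    where
    open ≡-Reasoning
    open import Algebra.Properties.CommutativeSemigroup ℕₚ.*-commutativeSemigroup using (x∙yz≈y∙xz)

  step-identity : ∀ α β r s b O → r + s ≡ suc b →
                  α * (O * inStep α β r s) + β * (O * outStep α β r s) ≡ suc b * O * ((α C r) * (β C s))
  step-identity α β r s b O r+s≡1+b = begin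
    α * (O * inStep α β r s) + β * (O * outStep α β r s) ≡⟨ factor α β O _ _ ⟩
    O * (α * inStep α β r s + β * outStep α β r s)       ≡⟨ cong (O *_) (cong₂ _+_ (α*inStep α β r s) (β*outStep α β r s)) ⟩
    O * (r * X + s * X)                                  ≡⟨ cong (O *_) (ℕₚ.*-distribʳ-+ X r s) ⟨
    O * ((r + s) * X)                                    ≡⟨ cong (λ t → O * (t * X)) r+s≡1+b ⟩
    O * (suc b * X)                                      ≡⟨ regroup O (suc b) X ⟩
    suc b * O * X                                        ∎
    where
    open ≡-Reasoning
    X = (α C r) * (β C s)
    factor : ∀ a b o x y → a * (o * x) + b * (o * y) ≡ o * (a * x + b * y)
    factor = solve-∀
    regroup : ∀ o m x → o * (m * x) ≡ m * o * x
    regroup = solve-∀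

  foldr-∨-allFin : ∀ {n} (p : Fin n → Bool) → foldr _∨_ false (map p (List.allFin n)) ≡ anyFin p
  foldr-∨-allFin {n} p = trans (cong (foldr _∨_ false) (Listₚ.map-tabulate (λ i → i) p)) (foldr-tabulate p)
    where
    foldr-tabulate : ∀ {m} (q : Fin m → Bool) → foldr _∨_ false (List.tabulate q) ≡ anyFin q
    foldr-tabulate {zero}  q = refl
    foldr-tabulate {suc m} q = cong (q zero ∨_) (foldr-tabulate (q ∘ suc))

  ∣p∣≡card-lookup : ∀ {n} (p : Subset n) → ∣ p ∣ ≡ card (lookup p)
  ∣p∣≡card-lookup []          = refl
  ∣p∣≡card-lookup (true ∷ p)  = cong suc (∣p∣≡card-lookup p)
  ∣p∣≡card-lookup (false ∷ p) = ∣p∣≡card-lookup p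

  ∈-allSubsets : ∀ {n} (p : Subset n) → p ∈ allSubsets n
  ∈-allSubsets []          = here refl
  ∈-allSubsets (true ∷ p)  = ∈-++⁺ˡ (∈-map⁺ (true ∷_) (∈-allSubsets p))
  ∈-allSubsets {suc n} (false ∷ p) = ∈-++⁺ʳ (map (true ∷_) (allSubsets n)) (∈-map⁺ (false ∷_) (∈-allSubsets p))

  allSubsets-unique : ∀ n → Unique (allSubsets n)
  allSubsets-unique zero    = All.[] AllPairs.∷ AllPairs.[]
  allSubsets-unique (suc n) = Uniqueₚ.++⁺ (Uniqueₚ.map⁺ ∷-injectiveʳ (allSubsets-unique n))
                                         (Uniqueₚ.map⁺ ∷-injectiveʳ (allSubsets-unique n))
                                         heads-differ
    where
    ∷-injectiveʳ : ∀ {b} {p q : Subset n} → b ∷ p ≡ b ∷ q → p ≡ q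
    ∷-injectiveʳ refl = refl
    heads-differ : ∀ {p} → ¬ (p ∈ map (true ∷_) (allSubsets n) × p ∈ map (false ∷_) (allSubsets n))
    heads-differ (p∈ₜ , p∈f) with ∈-map⁻ (true ∷_) p∈ₜ | ∈-map⁻ (false ∷_) p∈f
    ... | _ , _ , refl | _ , _ , ()

  ∁-involutive : ∀ {n} (p : Subset n) → ∁ (∁ p) ≡ p
  ∁-involutive []      = refl
  ∁-involutive (x ∷ p) = cong₂ _∷_ (Boolₚ.not-involutive x) (∁-involutive p)

  n<ᵇn≡false : ∀ n → (n <ᵇ n) ≡ false
  n<ᵇn≡false zero    = refl
  n<ᵇn≡false (suc n) = n<ᵇn≡false n

  punchIn-below : ∀ {n} (m : Fin (suc n)) (i : Fin n) → below (toℕ m) (punchIn m i) ≡ below (toℕ m) i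
  punchIn-below zero    i       = refl
  punchIn-below (suc m) zero    = refl
  punchIn-below (suc m) (suc i) = punchIn-below m i

  segmentPerm : ∀ {n} → Subset n → Permutation′ n
  segmentPerm []          = Permutation.id
  segmentPerm (true ∷ p)  = insert zero zero (segmentPerm p)
  segmentPerm (false ∷ p) = insert zero (fromℕ< (s≤s (∣p∣≤n p))) (segmentPerm p)

  segmentPerm-below : ∀ {n} (p : Subset n) j → below ∣ p ∣ (segmentPerm p ⟨$⟩ʳ j) ≡ lookup p j
  segmentPerm-below (true ∷ p)  zero    = refl
  segmentPerm-below (true ∷ p)  (suc j)
    rewrite insert-punchIn zero zero (segmentPerm p) j = segmentPerm-below p j
  segmentPerm-below (false ∷ p) zero
    rewrite Finₚ.toℕ-fromℕ< (s≤s (∣p∣≤n p)) = n<ᵇn≡false ∣ p ∣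
  segmentPerm-below (false ∷ p) (suc j)
    rewrite insert-punchIn zero (fromℕ< (s≤s (∣p∣≤n p))) (segmentPerm p) j
    = trans (subst (λ t → below t (punchIn m i) ≡ below t i) (Finₚ.toℕ-fromℕ< (s≤s (∣p∣≤n p))) (punchIn-below m i))
            (segmentPerm-below p j)
    where
    m = fromℕ< (s≤s (∣p∣≤n p))
    i = segmentPerm p ⟨$⟩ʳ j

  module _ {k : ℕ} where

    _⊕_ : (Fin k → Bool) → Fin k → Fin k → Bool
    (S ⊕ x) j = S j ∨ does (x Finₚ.≟ j)

    fresh : ∀ {n} → (Fin k → Bool) → Vec (Fin k) n → Bool
    fresh S []      = true
    fresh S (x ∷ v) = not (S x) ∧ fresh (S ⊕ x) v

    hits : ∀ {n} → (Fin k → Bool) → ℕ → Vec (Fin k) n → ℕ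
    hits P zero    v       = 0
    hits P (suc b) []      = 0
    hits P (suc b) (x ∷ v) = boolToℕ (P x) + hits P b v

    prefix : ∀ {n} → ℕ → Vec (Fin k) n → Fin k → Bool
    prefix b v j = anyFin (λ i → below b i ∧ ⌊ lookup v i Finₚ.≟ j ⌋)

    hits-+ : ∀ {n} P b (v : Vec (Fin k) n) → b ≤ n → hits P b v + hits (not ∘ P) b v ≡ b
    hits-+ P zero    v       _         = refl
    hits-+ P (suc b) (x ∷ v) (s≤s b≤n) = trans (shuffle (P x) (hits P b v) _) (cong suc (hits-+ P b v b≤n))
      where
      shuffle : ∀ p m n → boolToℕ p + m + (boolToℕ (not p) + n) ≡ suc (m + n)
      shuffle true  m n = refl
      shuffle false m n = ℕₚ.+-suc m n

    fresh-avoids : ∀ {n} T (v : Vec (Fin k) n) {y} → fresh T v ≡ true → T y ≡ true → ∀ i → lookup v i ≢ y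
    fresh-avoids T (x ∷ v) fresh≡true Tx≡true zero refl
      with () ← trans (cong not (sym Tx≡true)) (Boolₚ.∧-conicalˡ _ _ fresh≡true)
    fresh-avoids T (x ∷ v) fresh≡true Ty≡true (suc i) =
      fresh-avoids (T ⊕ x) v (Boolₚ.∧-conicalʳ _ _ fresh≡true) (cong (_∨ _) Ty≡true) i

    prefix-avoids : ∀ {n} T b (v : Vec (Fin k) n) {y} → fresh T v ≡ true → T y ≡ true → prefix b v y ≡ false
    prefix-avoids T b v fresh≡true Ty≡true = anyFin-false λ i →
      trans (cong (below b i ∧_) (trans (isYes≗does _) (dec-false (lookup v i Finₚ.≟ _) (fresh-avoids T v fresh≡true Ty≡true i))))
            (Boolₚ.∧-zeroʳ _)

    card-prefix : ∀ {n} S P b (v : Vec (Fin k) n) → fresh S v ≡ true → card (λ j → P j ∧ prefix b v j) ≡ hits P b v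
    card-prefix {n} S P zero v _ = card-false {k} λ j → trans (cong (P j ∧_) (anyFin-false {n} λ _ → refl)) (Boolₚ.∧-zeroʳ _)
    card-prefix S P (suc b) [] _ = card-false {k} λ j → Boolₚ.∧-zeroʳ _
    card-prefix S P (suc b) (x ∷ v) fresh≡true = begin
      card f                       ≡⟨ card-insert f g x agree gx≡false ⟩
      card g + boolToℕ (f x)       ≡⟨ cong₂ _+_ (card-prefix (S ⊕ x) P b v (Boolₚ.∧-conicalʳ _ _ fresh≡true)) (cong boolToℕ fx≡Px) ⟩
      hits P b v + boolToℕ (P x)   ≡⟨ ℕₚ.+-comm (hits P b v) _ ⟩
      boolToℕ (P x) + hits P b v   ∎
      where
      open ≡-Reasoning
      Y = prefix b v
      f g : Fin k → Bool
      f j = P j ∧ (⌊ x Finₚ.≟ j ⌋ ∨ Y j)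
      g j = P j ∧ Y j
      agree : ∀ j → j ≢ x → f j ≡ g j
      agree j j≢x = cong (λ t → P j ∧ (t ∨ Y j)) (trans (isYes≗does _) (dec-false (x Finₚ.≟ j) (j≢x ∘ sym)))
      Yx≡false : Y x ≡ false
      Yx≡false = prefix-avoids (S ⊕ x) b v (Boolₚ.∧-conicalʳ _ _ fresh≡true)
                   (trans (cong (S x ∨_) (dec-true (x Finₚ.≟ x) refl)) (Boolₚ.∨-zeroʳ _))
      gx≡false : g x ≡ false
      gx≡false = trans (cong (P x ∧_) Yx≡false) (Boolₚ.∧-zeroʳ _)
      fx≡Px : f x ≡ P x
      fx≡Px = trans (cong (λ t → P x ∧ (t ∨ Y x)) (trans (isYes≗does _) (dec-true (x Finₚ.≟ x) refl))) (Boolₚ.∧-identityʳ _)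

    avoids : ∀ {n} → (Fin k → Bool) → Vec (Fin k) n → Bool
    avoids S []      = true
    avoids S (x ∷ v) = not (S x) ∧ avoids S v

    distinct : ∀ {n} → Vec (Fin k) n → Bool
    distinct v = does (UniqueDec.unique? Finₚ._≟_ (toList v))

    notIn : ∀ {n} → Fin k → Vec (Fin k) n → Bool
    notIn x v = does (all? (λ y → ¬? (x Finₚ.≟ y)) (toList v))

    avoids-⊕ : ∀ {n} S x (v : Vec (Fin k) n) → avoids (S ⊕ x) v ≡ avoids S v ∧ notIn x v
    avoids-⊕ S x []      = refl
    avoids-⊕ S x (y ∷ v) = trans (cong₂ _∧_ (deMorgan₂ (S y) _) (avoids-⊕ S x v))
                                 (∧-interchange (not (S y)) _ (avoids S v) (notIn x v))

    fresh≡avoids∧distinct : ∀ {n} S (v : Vec (Fin k) n) → fresh S v ≡ avoids S v ∧ distinct v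
    fresh≡avoids∧distinct S []      = refl
    fresh≡avoids∧distinct S (x ∷ v) = begin
      not (S x) ∧ fresh (S ⊕ x) v                     ≡⟨ cong (not (S x) ∧_) (fresh≡avoids∧distinct (S ⊕ x) v) ⟩
      not (S x) ∧ (avoids (S ⊕ x) v ∧ distinct v)     ≡⟨ cong (λ t → not (S x) ∧ (t ∧ distinct v)) (avoids-⊕ S x v) ⟩
      not (S x) ∧ ((avoids S v ∧ notIn x v) ∧ distinct v) ≡⟨ cong (not (S x) ∧_) (Boolₚ.∧-assoc (avoids S v) (notIn x v) _) ⟩
      not (S x) ∧ (avoids S v ∧ (notIn x v ∧ distinct v)) ≡⟨ Boolₚ.∧-assoc (not (S x)) (avoids S v) _ ⟨
      (not (S x) ∧ avoids S v) ∧ distinct (x ∷ v)     ∎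
      where open ≡-Reasoning
    fresh-∅≡distinct : ∀ {n} (v : Vec (Fin k) n) → fresh (λ _ → false) v ≡ distinct v
    fresh-∅≡distinct v = trans (fresh≡avoids∧distinct _ v) (cong (_∧ distinct v) (avoids-∅ v))
      where
      avoids-∅ : ∀ {n} (v : Vec (Fin k) n) → avoids (λ _ → false) v ≡ true
      avoids-∅ []      = refl
      avoids-∅ (x ∷ v) = avoids-∅ v

    card-⊕ : ∀ (C S : Fin k → Bool) i → S i ≡ false →
             card (λ j → C j ∧ not ((S ⊕ i) j)) + boolToℕ (C i) ≡ card (λ j → C j ∧ not (S j))
    card-⊕ C S i Si≡false = begin
      card f + boolToℕ (C i)   ≡⟨ cong (λ t → card f + boolToℕ t) gi≡Ci ⟨
      card f + boolToℕ (g i)   ≡⟨ card-insert g f i agree fi≡false ⟨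
      card g                   ∎
      where
      open ≡-Reasoning
      f g : Fin k → Bool
      f j = C j ∧ not ((S ⊕ i) j)
      g j = C j ∧ not (S j)
      agree : ∀ j → j ≢ i → g j ≡ f j
      agree j j≢i = cong (λ t → C j ∧ not t) (sym (trans (cong (S j ∨_) (dec-false (i Finₚ.≟ j) (j≢i ∘ sym))) (Boolₚ.∨-identityʳ _)))
      fi≡false : f i ≡ false
      fi≡false = trans (cong (λ t → C i ∧ not (S i ∨ t)) (dec-true (i Finₚ.≟ i) refl))
                       (trans (cong (λ t → C i ∧ not t) (Boolₚ.∨-zeroʳ (S i))) (Boolₚ.∧-zeroʳ (C i)))
      gi≡Ci : g i ≡ C i
      gi≡Ci = trans (cong (λ t → C i ∧ not t) Si≡false) (Boolₚ.∧-identityʳ (C i))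

does-≡ : ∀ {p q} {P : Set p} {Q : Set q} (P? : Dec P) (Q? : Dec Q) → (P → Q) → (Q → P) → does P? ≡ does Q?
does-≡ P? (yes q) _ Q→P = dec-true P? (Q→P q)
does-≡ P? (no ¬q) P→Q _ = dec-false P? (¬q ∘ P→Q)

module FiniteSums {c ℓ} (R : CommutativeRing c ℓ) where
  open CommutativeRing R hiding (zero)
  open import Relation.Binary.Reasoning.Setoid setoid
  open import Algebra.Properties.Ring ring using (-1*x≈-x)
  open import Algebra.Properties.Semiring.Mult semiring using (×-homo-+; ×1-homo-*) renaming (_×_ to _·_)

  ∑ : ∀ {a} {A : Set a} → List A → (A → Carrier) → Carrier
  ∑ xs f = foldr (λ x r → f x + r) 0# xs

  χ : Bool → Carrier
  χ true  = 1#
  χ false = 0#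

  χ-∧ : ∀ x y → χ (x ∧ y) ≈ χ x * χ y
  χ-∧ true  y = sym (*-identityˡ _)
  χ-∧ false y = sym (zeroˡ _)

  δ : ℕ → ℕ → Carrier
  δ m n = χ (does (m ℕₚ.≟ n))

  δ-refl : ∀ n → δ n n ≈ 1#
  δ-refl n = reflexive (≡.cong χ (dec-true (n ℕₚ.≟ n) ≡.refl))

  δ-≢ : ∀ {m n} → m ≢ n → δ m n ≈ 0#
  δ-≢ {m} {n} m≢n = reflexive (≡.cong χ (dec-false (m ℕₚ.≟ n) m≢n))

  δ-sym : ∀ m n → δ m n ≡ δ n m
  δ-sym m n = ≡.cong χ (does-≡ (m ℕₚ.≟ n) (n ℕₚ.≟ m) ≡.sym ≡.sym)

  χ-*-cong : ∀ b {x y} → (b ≡ true → x ≈ y) → χ b * x ≈ χ b * y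
  χ-*-cong true  x≈y = *-congˡ (x≈y ≡.refl)
  χ-*-cong false _   = trans (zeroˡ _) (sym (zeroˡ _))

  module _ {a} {A : Set a} where

    ∑-cong : ∀ xs {f g : A → Carrier} → (∀ x → f x ≈ g x) → ∑ xs f ≈ ∑ xs g
    ∑-cong []       f≈g = refl
    ∑-cong (x ∷ xs) f≈g = +-cong (f≈g x) (∑-cong xs f≈g)

    ∑-cong-∈ : ∀ xs {f g : A → Carrier} → (∀ {x} → x ∈ xs → f x ≈ g x) → ∑ xs f ≈ ∑ xs g
    ∑-cong-∈ []       f≈g = refl
    ∑-cong-∈ (x ∷ xs) f≈g = +-cong (f≈g (here ≡.refl)) (∑-cong-∈ xs (f≈g ∘ there))

    ∑-0 : ∀ xs → ∑ xs (λ (_ : A) → 0#) ≈ 0#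
    ∑-0 []       = refl
    ∑-0 (x ∷ xs) = trans (+-identityˡ _) (∑-0 xs)

    ∑-+ : ∀ xs (f g : A → Carrier) → ∑ xs (λ x → f x + g x) ≈ ∑ xs f + ∑ xs g
    ∑-+ []       f g = sym (+-identityˡ _)
    ∑-+ (x ∷ xs) f g = begin
      (f x + g x) + ∑ xs (λ x → f x + g x) ≈⟨ +-congˡ (∑-+ xs f g) ⟩
      (f x + g x) + (∑ xs f + ∑ xs g)      ≈⟨ +-assoc _ _ _ ⟩
      f x + (g x + (∑ xs f + ∑ xs g))      ≈⟨ +-congˡ (x∙yz≈y∙xz _ _ _) ⟩
      f x + (∑ xs f + (g x + ∑ xs g))      ≈⟨ +-assoc _ _ _ ⟨
      (f x + ∑ xs f) + (g x + ∑ xs g)      ∎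
      where open import Algebra.Properties.CommutativeSemigroup +-commutativeSemigroup using (x∙yz≈y∙xz)

    ∑-*ˡ : ∀ xs z (f : A → Carrier) → ∑ xs (λ x → z * f x) ≈ z * ∑ xs f
    ∑-*ˡ []       z f = sym (zeroʳ z)
    ∑-*ˡ (x ∷ xs) z f = trans (+-congˡ (∑-*ˡ xs z f)) (sym (distribˡ z (f x) (∑ xs f)))

    ∑-*ʳ : ∀ xs z (f : A → Carrier) → ∑ xs (λ x → f x * z) ≈ ∑ xs f * z
    ∑-*ʳ xs z f = begin
      ∑ xs (λ x → f x * z) ≈⟨ ∑-cong xs (λ x → *-comm (f x) z) ⟩
      ∑ xs (λ x → z * f x) ≈⟨ ∑-*ˡ xs z f ⟩
      z * ∑ xs f           ≈⟨ *-comm z _ ⟩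
      ∑ xs f * z           ∎

    ∑-minus : ∀ xs (f g : A → Carrier) → ∑ xs (λ x → f x - g x) ≈ ∑ xs f - ∑ xs g
    ∑-minus xs f g = begin
      ∑ xs (λ x → f x - g x)           ≈⟨ ∑-+ xs f (λ x → - g x) ⟩
      ∑ xs f + ∑ xs (λ x → - g x)      ≈⟨ +-congˡ (∑-cong xs (λ x → sym (-1*x≈-x (g x)))) ⟩
      ∑ xs f + ∑ xs (λ x → - 1# * g x) ≈⟨ +-congˡ (∑-*ˡ xs (- 1#) g) ⟩
      ∑ xs f + - 1# * ∑ xs g           ≈⟨ +-congˡ (-1*x≈-x _) ⟩
      ∑ xs f - ∑ xs g                  ∎

    ∑-++ : ∀ xs ys (f : A → Carrier) → ∑ (xs ++ ys) f ≈ ∑ xs f + ∑ ys f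
    ∑-++ []       ys f = sym (+-identityˡ _)
    ∑-++ (x ∷ xs) ys f = trans (+-congˡ (∑-++ xs ys f)) (sym (+-assoc _ _ _))

    ∑-filter : ∀ {p} {P : A → Set p} (P? : Decidable P) xs (f : A → Carrier) →
               ∑ (filter P? xs) f ≈ ∑ xs (λ x → χ (does (P? x)) * f x)
    ∑-filter P? []       f = refl
    ∑-filter P? (x ∷ xs) f with does (P? x)
    ... | true  = +-cong (sym (*-identityˡ _)) (∑-filter P? xs f)
    ... | false = trans (∑-filter P? xs f) (trans (sym (+-identityˡ _)) (+-congʳ (sym (zeroˡ _))))

    ∑-pick : (_≟_ : DecidableEquality A) {xs : List A} → Unique xs → ∀ {x} → x ∈ xs →
             (f : A → Carrier) → ∑ xs (λ y → χ (does (y ≟ x)) * f y) ≈ f x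
    ∑-pick _≟_ {x ∷ xs} (x∉xs ∷ _) (here ≡.refl) f = begin
      χ (does (x ≟ x)) * f x + ∑ xs (λ y → χ (does (y ≟ x)) * f y)
        ≈⟨ +-cong (*-congʳ (reflexive (≡.cong χ (dec-true (x ≟ x) ≡.refl))))
                  (∑-cong-∈ xs (λ y∈xs → χ-false*f (All.lookup x∉xs y∈xs ∘ ≡.sym))) ⟩
      1# * f x + ∑ xs (λ _ → 0#) ≈⟨ +-cong (*-identityˡ _) (∑-0 xs) ⟩
      f x + 0#                   ≈⟨ +-identityʳ _ ⟩
      f x                        ∎
      where
      χ-false*f : ∀ {y} → y ≢ x → χ (does (y ≟ x)) * f y ≈ 0#
      χ-false*f y≢x = trans (*-congʳ (reflexive (≡.cong χ (dec-false (_ ≟ x) y≢x)))) (zeroˡ _)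
    ∑-pick _≟_ {y ∷ xs} (y∉xs ∷ xs!) {x} (there x∈xs) f = begin
      χ (does (y ≟ x)) * f y + ∑ xs (λ z → χ (does (z ≟ x)) * f z)
        ≈⟨ +-cong (trans (*-congʳ (reflexive (≡.cong χ (dec-false (y ≟ x) y≢x)))) (zeroˡ _))
                  (∑-pick _≟_ xs! x∈xs f) ⟩
      0# + f x ≈⟨ +-identityˡ _ ⟩
      f x      ∎
      where
      y≢x : y ≢ x
      y≢x ≡.refl = All.lookup y∉xs x∈xs ≡.refl

  ∑-map : ∀ {a b} {A : Set a} {B : Set b} (g : A → B) xs (f : B → Carrier) →
          ∑ (map g xs) f ≡ ∑ xs (f ∘ g)
  ∑-map g []       f = ≡.refl
  ∑-map g (x ∷ xs) f = ≡.cong (f (g x) +_) (∑-map g xs f)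

  ∑-swap : ∀ {a b} {A : Set a} {B : Set b} xs ys (f : A → B → Carrier) →
           ∑ xs (λ x → ∑ ys (f x)) ≈ ∑ ys (λ y → ∑ xs (λ x → f x y))
  ∑-swap []       ys f = sym (∑-0 ys)
  ∑-swap (x ∷ xs) ys f = trans (+-congˡ (∑-swap xs ys f)) (sym (∑-+ ys (f x) _))

  castR≈·1# : ∀ n → castR R n ≈ n · 1#
  castR≈·1# zero    = refl
  castR≈·1# (suc n) = +-congˡ (castR≈·1# n)

  castR-+ : ∀ m n → castR R (m ℕ.+ n) ≈ castR R m + castR R n
  castR-+ m n = begin
    castR R (m ℕ.+ n)         ≈⟨ castR≈·1# (m ℕ.+ n) ⟩
    (m ℕ.+ n) · 1#            ≈⟨ ×-homo-+ 1# m n ⟩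
    m · 1# + n · 1#           ≈⟨ +-cong (castR≈·1# m) (castR≈·1# n) ⟨
    castR R m + castR R n     ∎

  castR-* : ∀ m n → castR R (m ℕ.* n) ≈ castR R m * castR R n
  castR-* m n = begin
    castR R (m ℕ.* n)         ≈⟨ castR≈·1# (m ℕ.* n) ⟩
    (m ℕ.* n) · 1#            ≈⟨ ×1-homo-* m n ⟩
    (m · 1#) * (n · 1#)       ≈⟨ *-cong (castR≈·1# m) (castR≈·1# n) ⟨
    castR R m * castR R n     ∎

  castR-boolToℕ : ∀ b → castR R (boolToℕ b) ≈ χ b
  castR-boolToℕ true  = +-identityʳ 1#
  castR-boolToℕ false = refl

  castR-cong : ∀ {m n} → m ≡ n → castR R m ≈ castR R n
  castR-cong ≡.refl = refl

  ∑-χ≈card : ∀ {n} (B : Fin n → Bool) → ∑ (List.allFin n) (χ ∘ B) ≈ castR R (card B)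
  ∑-χ≈card = ∑-tabulate-χ (λ i → i)
    where
    ∑-tabulate-χ : ∀ {m n} (g : Fin m → Fin n) (B : Fin n → Bool) → ∑ (List.tabulate g) (χ ∘ B) ≈ castR R (card (B ∘ g))
    ∑-tabulate-χ {zero}  g B = refl
    ∑-tabulate-χ {suc m} g B = begin
      χ (B (g zero)) + ∑ (List.tabulate (g ∘ suc)) (χ ∘ B)
        ≈⟨ +-cong (castR-boolToℕ (B (g zero))) (sym (∑-tabulate-χ (g ∘ suc) B)) ⟨
      castR R (boolToℕ (B (g zero))) + castR R (card (B ∘ g ∘ suc))
        ≈⟨ castR-+ (boolToℕ (B (g zero))) (card (B ∘ g ∘ suc)) ⟨
      castR R (card (B ∘ g)) ∎

  ∑-χ*const : ∀ {n} (B : Fin n → Bool) (h : Fin n → Carrier) X → (∀ i → B i ≡ true → h i ≈ X) →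
              ∑ (List.allFin n) (λ i → χ (B i) * h i) ≈ castR R (card B) * X
  ∑-χ*const {n} B h X h≈X = begin
    ∑ (List.allFin n) (λ i → χ (B i) * h i) ≈⟨ ∑-cong (List.allFin n) (λ i → χ-*-cong (B i) (h≈X i)) ⟩
    ∑ (List.allFin n) (λ i → χ (B i) * X)   ≈⟨ ∑-*ʳ (List.allFin n) X (χ ∘ B) ⟩
    ∑ (List.allFin n) (χ ∘ B) * X           ≈⟨ *-congʳ (∑-χ≈card B) ⟩
    castR R (card B) * X                    ∎

  ∑-allVecs-suc : ∀ k n (f : Vec (Fin k) (suc n) → Carrier) →
                  ∑ (allVecs k (suc n)) f ≈ ∑ (List.allFin k) (λ i → ∑ (allVecs k n) (f ∘ (i ∷_)))
  ∑-allVecs-suc k n f = go (List.allFin k)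
    where
    go : ∀ is → ∑ (foldr (λ i acc → map (i ∷_) (allVecs k n) ++ acc) [] is) f ≈ ∑ is (λ i → ∑ (allVecs k n) (f ∘ (i ∷_)))
    go []       = refl
    go (i ∷ is) = begin
      ∑ (map (i ∷_) (allVecs k n) ++ rest) f        ≈⟨ ∑-++ (map (i ∷_) (allVecs k n)) rest f ⟩
      ∑ (map (i ∷_) (allVecs k n)) f + ∑ rest f     ≈⟨ +-cong (reflexive (∑-map (i ∷_) (allVecs k n) f)) (go is) ⟩
      ∑ (allVecs k n) (f ∘ (i ∷_)) + _             ∎
      where rest = foldr (λ i acc → map (i ∷_) (allVecs k n) ++ acc) [] is

module Coinvariants {c ℓ} (F : CharZeroField c ℓ) (k : ℕ) where
  open CharZeroField F
  open Coinv F k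
  open FiniteSums ring
  open import Relation.Binary.Reasoning.Setoid setoid
  open import Algebra.Properties.CommutativeSemigroup *-commutativeSemigroup using (x∙yz≈y∙xz)
  open import Algebra.Properties.Ring (CommutativeRing.ring ring) using (-0#≈0#; x[y-z]≈xy-xz)

  ind≡χ-does : ∀ {P : Set} (p : Dec P) → ind p ≡ χ (does p)
  ind≡χ-does (yes _) = ≡.refl
  ind≡χ-does (no _)  = ≡.refl

  basis-sym : ∀ s d → basis s d ≡ basis d s
  basis-sym s d = ≡.trans (ind≡χ-does (d ≟S s))
    (≡.trans (≡.cong χ (does-≡ (d ≟S s) (s ≟S d) ≡.sym ≡.sym)) (≡.sym (ind≡χ-does (s ≟S d))))

  ∑-basis : ∀ s (f : Subset k → Carrier) → ∑ (allSubsets k) (λ d → basis s d * f d) ≈ f s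
  ∑-basis s f = trans (∑-cong (allSubsets k) (λ d → *-congʳ (reflexive (ind≡χ-does (d ≟S s)))))
                      (∑-pick _≟S_ (allSubsets-unique k) (∈-allSubsets s) f)

  ∣seg∣ : ∀ {m} → m ≤ k → ∣ seg m ∣ ≡ m
  ∣seg∣ {m} m≤k = ≡.trans (∣p∣≡card-lookup (seg m))
    (≡.trans (card-cong {k} (Vecₚ.lookup∘tabulate (below m))) (card-below m m≤k))

  lookup-image : ∀ σ s j → lookup (image σ s) j ≡ anyFin (λ i → lookup s i ∧ ⌊ σ i Finₚ.≟ j ⌋)
  lookup-image σ s j = ≡.trans (Vecₚ.lookup∘tabulate _ j) (foldr-∨-allFin {k} _)

  lookup-image-inverse : ∀ σ ρ → (∀ i → ρ (σ i) ≡ i) → (∀ j → σ (ρ j) ≡ j) →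
                         ∀ s j → lookup (image σ s) j ≡ lookup s (ρ j)
  lookup-image-inverse σ ρ ρσ σρ s j =
    ≡.trans (lookup-image σ s j) (≡.trans (anyFin-unique {k} _ (ρ j) only-ρj)
      (≡.trans (≡.cong (lookup s (ρ j) ∧_) (≡.trans (isYes≗does _) (dec-true (σ (ρ j) Finₚ.≟ j) (σρ j)))) (Boolₚ.∧-identityʳ _)))
    where
    only-ρj : ∀ i → i ≢ ρ j → (lookup s i ∧ ⌊ σ i Finₚ.≟ j ⌋) ≡ false
    only-ρj i i≢ρj = ≡.trans (≡.cong (lookup s i ∧_) (≡.trans (isYes≗does _) (dec-false (σ i Finₚ.≟ j) σi≢j)))
                             (Boolₚ.∧-zeroʳ _)
      where
      σi≢j : σ i ≢ j
      σi≢j σi≡j = i≢ρj (≡.trans (≡.sym (ρσ i)) (≡.cong ρ σi≡j))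

  image-segmentPerm : ∀ d → image (segmentPerm d ⟨$⟩ˡ_) (seg ∣ d ∣) ≡ d
  image-segmentPerm d = ≡.trans (Vecₚ.tabulate-cong (λ j → ≡.trans (≡.sym (Vecₚ.lookup∘tabulate _ j)) (pointwise j)))
                                (Vecₚ.tabulate∘lookup d)
    where
    π = segmentPerm d
    pointwise : ∀ j → lookup (image (π ⟨$⟩ˡ_) (seg ∣ d ∣)) j ≡ lookup d j
    pointwise j = ≡.trans (lookup-image-inverse (π ⟨$⟩ˡ_) (π ⟨$⟩ʳ_) (λ _ → inverseʳ π) (λ _ → inverseˡ π) (seg ∣ d ∣) j)
                          (≡.trans (Vecₚ.lookup∘tabulate (below ∣ d ∣) _) (segmentPerm-below d j))

  act-basis : ∀ σ s e → act σ (basis s) e ≈ basis (image σ s) e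
  act-basis σ s e = begin
    ∑ (allSubsets k) (λ c → ind (image σ c ≟S e) * basis s c) ≈⟨ ∑-cong (allSubsets k) (λ c → *-comm _ _) ⟩
    ∑ (allSubsets k) (λ c → basis s c * ind (image σ c ≟S e)) ≈⟨ ∑-basis s _ ⟩
    basis e (image σ s)                                        ≡⟨ basis-sym e (image σ s) ⟩
    basis (image σ s) e                                        ∎

  bilinear : (Subset k → Subset k → Subset k) → V → V → V
  bilinear _⊙_ u v d = ∑ (allSubsets k) (λ x → ∑ (allSubsets k) (λ y → ind ((x ⊙ y) ≟S d) * (u x * v y)))

  bilinear-basis : ∀ _⊙_ s t {v} → (∀ y → v y ≈ basis t y) → ∀ d → bilinear _⊙_ (basis s) v d ≈ basis (s ⊙ t) d
  bilinear-basis _⊙_ s t {v} v≈t d = begin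
    ∑ (allSubsets k) (λ x → ∑ (allSubsets k) (λ y → ind ((x ⊙ y) ≟S d) * (basis s x * v y)))
      ≈⟨ ∑-cong (allSubsets k) (λ x → trans (∑-cong (allSubsets k) (λ y → x∙yz≈y∙xz _ _ _)) (∑-*ˡ (allSubsets k) _ _)) ⟩
    ∑ (allSubsets k) (λ x → basis s x * ∑ (allSubsets k) (λ y → ind ((x ⊙ y) ≟S d) * v y))
      ≈⟨ ∑-basis s _ ⟩
    ∑ (allSubsets k) (λ y → ind ((s ⊙ y) ≟S d) * v y)
      ≈⟨ ∑-cong (allSubsets k) (λ y → trans (*-congˡ (v≈t y)) (*-comm _ _)) ⟩
    ∑ (allSubsets k) (λ y → basis t y * ind ((s ⊙ y) ≟S d))
      ≈⟨ ∑-basis t _ ⟩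
    basis d (s ⊙ t)
      ≡⟨ basis-sym d (s ⊙ t) ⟩
    basis (s ⊙ t) d ∎

  levelSum : ℕ → V → Carrier
  levelSum j w = ∑ (allSubsets k) (λ d → δ ∣ d ∣ j * w d)

  levelSum-cong : ∀ j {u v : V} → (∀ d → u d ≈ v d) → levelSum j u ≈ levelSum j v
  levelSum-cong j u≈v = ∑-cong (allSubsets k) (λ d → *-congˡ (u≈v d))

  levelSum-basis : ∀ j s → levelSum j (basis s) ≈ δ ∣ s ∣ j
  levelSum-basis j s = trans (∑-cong (allSubsets k) (λ d → *-comm _ _)) (∑-basis s (λ d → δ ∣ d ∣ j))

  levelSum-*ˡ : ∀ j z (w : V) → levelSum j (λ d → z * w d) ≈ z * levelSum j w
  levelSum-*ˡ j z w = trans (∑-cong (allSubsets k) (λ d → x∙yz≈y∙xz _ _ _)) (∑-*ˡ (allSubsets k) z _)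

  levelSum-minus : ∀ j (u v : V) → levelSum j (λ d → u d - v d) ≈ levelSum j u - levelSum j v
  levelSum-minus j u v = trans (∑-cong (allSubsets k) (λ d → x[y-z]≈xy-xz _ _ _)) (∑-minus (allSubsets k) _ _)

  levelSum-∑ : ∀ {a} {A : Set a} j (xs : List A) (w : A → V) →
               levelSum j (λ d → ∑ xs (λ x → w x d)) ≈ ∑ xs (λ x → levelSum j (w x))
  levelSum-∑ j xs w = trans (∑-cong (allSubsets k) (λ d → sym (∑-*ˡ xs _ _))) (∑-swap (allSubsets k) xs _)

  levelSum-average : ∀ j _⊙_ s t z (σs : List (Fin k → Fin k)) →
                    levelSum j (λ d → z * ∑ σs (λ σ → bilinear _⊙_ (basis s) (act σ (basis t)) d))
                    ≈ z * ∑ σs (λ σ → δ ∣ s ⊙ image σ t ∣ j)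
  levelSum-average j _⊙_ s t z σs = begin
    levelSum j (λ d → z * ∑ σs (λ σ → bilinear _⊙_ (basis s) (act σ (basis t)) d))
      ≈⟨ levelSum-*ˡ j z _ ⟩
    z * levelSum j (λ d → ∑ σs (λ σ → bilinear _⊙_ (basis s) (act σ (basis t)) d))
      ≈⟨ *-congˡ (levelSum-∑ j σs _) ⟩
    z * ∑ σs (λ σ → levelSum j (bilinear _⊙_ (basis s) (act σ (basis t))))
      ≈⟨ *-congˡ (∑-cong σs λ σ → trans (levelSum-cong j (bilinear-basis _⊙_ s (image σ t) (act-basis σ t)))
                                          (levelSum-basis j (s ⊙ image σ t))) ⟩
    z * ∑ σs (λ σ → δ ∣ s ⊙ image σ t ∣ j) ∎

  levelSum-combination : ∀ j z (L : List ℕ) (c : ℕ → Carrier) (ψ : ℕ → ℕ) → (∀ {l} → l ∈ L → ψ l ≤ k) →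
                         levelSum j (λ d → z * ∑ L (λ l → c l * basis (seg (ψ l)) d)) ≈ z * ∑ L (λ l → c l * δ (ψ l) j)
  levelSum-combination j z L c ψ ψ≤k = begin
    levelSum j (λ d → z * ∑ L (λ l → c l * basis (seg (ψ l)) d))
      ≈⟨ levelSum-*ˡ j z _ ⟩
    z * levelSum j (λ d → ∑ L (λ l → c l * basis (seg (ψ l)) d))
      ≈⟨ *-congˡ (levelSum-∑ j L _) ⟩
    z * ∑ L (λ l → levelSum j (λ d → c l * basis (seg (ψ l)) d))
      ≈⟨ *-congˡ (∑-cong-∈ L λ {l} l∈L → trans (levelSum-*ˡ j (c l) _)
                   (*-congˡ (trans (levelSum-basis j (seg (ψ l))) (reflexive (≡.cong (λ m → δ m j) (∣seg∣ (ψ≤k l∈L))))))) ⟩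
    z * ∑ L (λ l → c l * δ (ψ l) j) ∎

  complV-basis : ∀ s d → complV (basis s) d ≈ basis (∁ s) d
  complV-basis s d = reflexive (≡.trans (ind≡χ-does (∁ d ≟S s)) (≡.trans (≡.cong χ (does-≡ (∁ d ≟S s) (d ≟S ∁ s) to from))
                                                                          (≡.sym (ind≡χ-does (d ≟S ∁ s)))))
    where
    to : ∁ d ≡ s → d ≡ ∁ s
    to ∁d≡s = ≡.trans (≡.sym (∁-involutive d)) (≡.cong ∁ ∁d≡s)
    from : d ≡ ∁ s → ∁ d ≡ s
    from d≡∁s = ≡.trans (≡.cong ∁ d≡∁s) (∁-involutive s)

  basis-seg : ∀ {m} e → m ≤ k → basis (seg m) e ≈ δ m ∣ e ∣ * basis (seg ∣ e ∣) e
  basis-seg {m} e m≤k with m ℕₚ.≟ ∣ e ∣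
  ... | yes ≡.refl = sym (trans (*-congʳ (δ-refl m)) (*-identityˡ _))
  ... | no m≢∣e∣   = trans (reflexive (≡.trans (ind≡χ-does (e ≟S seg m)) (≡.cong χ (dec-false (e ≟S seg m) e≢seg))))
                           (sym (trans (*-congʳ (δ-≢ m≢∣e∣)) (zeroˡ _)))
    where
    e≢seg : e ≢ seg m
    e≢seg e≡seg = m≢∣e∣ (≡.trans (≡.sym (∣seg∣ m≤k)) (≡.cong ∣_∣ (≡.sym e≡seg)))

  inW-if-levelSums-vanish : ∀ w → (∀ j → levelSum j w ≈ 0#) → InW w
  inW-if-levelSums-vanish w vanish = map generator (allSubsets k) , λ e → sym (decomposition e)
    where
    τ : Subset k → Perm
    τ d = (π ⟨$⟩ˡ_) , λ eq → ≡.trans (≡.sym (inverseʳ π)) (≡.trans (≡.cong (π ⟨$⟩ʳ_) eq) (inverseʳ π))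
      where π = segmentPerm d
    generator : Subset k → Carrier × Perm × V
    generator d = w d , τ d , basis (seg ∣ d ∣)
    decomposition : ∀ e → sumL′ (map generator (allSubsets k)) (λ { (x , (σ , _) , v) → x * (act σ v e - v e) }) ≈ w e
    decomposition e = begin
      ∑ (map generator L) (λ { (x , (σ , _) , v) → x * (act σ v e - v e) })
        ≡⟨ ∑-map generator L _ ⟩
      ∑ L (λ d → w d * (act (σ d) (β d) e - β d e))
        ≈⟨ ∑-cong L (λ d → x[y-z]≈xy-xz _ _ _) ⟩
      ∑ L (λ d → w d * act (σ d) (β d) e - w d * β d e)
        ≈⟨ ∑-minus L _ _ ⟩
      ∑ L (λ d → w d * act (σ d) (β d) e) - ∑ L (λ d → w d * β d e)
        ≈⟨ +-cong permuted-part (-‿cong segment-part) ⟩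
      w e - 0#
        ≈⟨ +-congˡ -0#≈0# ⟩
      w e + 0#
        ≈⟨ +-identityʳ _ ⟩
      w e ∎
      where
      L = allSubsets k
      σ = λ d → proj₁ (τ d)
      β = λ d → basis (seg ∣ d ∣)
      permuted-part : ∑ L (λ d → w d * act (σ d) (β d) e) ≈ w e
      permuted-part = trans (∑-cong L (λ d → trans (*-congˡ (act-basis (σ d) (seg ∣ d ∣) e))
                                            (trans (*-comm _ _) (*-congʳ (reflexive (moves-to d))))))
                            (∑-basis e w)
        where
        moves-to : ∀ d → basis (image (σ d) (seg ∣ d ∣)) e ≡ basis e d
        moves-to d = ≡.trans (≡.cong (λ s → basis s e) (image-segmentPerm d)) (basis-sym d e)
      segment-part : ∑ L (λ d → w d * β d e) ≈ 0#
      segment-part = begin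
        ∑ L (λ d → w d * β d e)
          ≈⟨ ∑-cong L (λ d → trans (*-congˡ (basis-seg e (∣p∣≤n d))) (trans (sym (*-assoc _ _ _)) (*-congʳ (*-comm _ _)))) ⟩
        ∑ L (λ d → δ ∣ d ∣ ∣ e ∣ * w d * β e e)
          ≈⟨ ∑-*ʳ L _ _ ⟩
        levelSum ∣ e ∣ w * β e e
          ≈⟨ *-congʳ (vanish ∣ e ∣) ⟩
        0# * β e e
          ≈⟨ zeroˡ _ ⟩
        0# ∎

  levelSums-determine-class : ∀ u v → (∀ j → levelSum j u ≈ levelSum j v) → u ∼ v
  levelSums-determine-class u v u≈v = inW-if-levelSums-vanish _ λ j → begin
    levelSum j (λ d → u d - v d) ≈⟨ levelSum-minus j u v ⟩
    levelSum j u - levelSum j v  ≈⟨ +-congʳ (u≈v j) ⟩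
    levelSum j v - levelSum j v  ≈⟨ -‿inverseʳ _ ⟩
    0#                           ∎

module Counting {c ℓ} (F : CharZeroField c ℓ) (k : ℕ) (P : Fin k → Bool) where
  open CharZeroField F hiding (zero)
  open FiniteSums ring
  open import Relation.Binary.Reasoning.Setoid setoid

  α β : (Fin k → Bool) → ℕ
  α S = card (λ j → P j ∧ not (S j))
  β S = card (λ j → not (P j) ∧ not (S j))

  Count : ℕ → (Fin k → Bool) → ℕ → ℕ → ℕ → Carrier
  Count n S b r s = ∑ (allVecs k n) (λ v → χ (fresh S v) * (δ (hits P b v) r * δ (hits (not ∘ P) b v) s))

  orderings : ℕ → ℕ → ℕ
  orderings n b = b ! ℕ.* (n ∸ b) !

  choices : (Fin k → Bool) → ℕ → ℕ → ℕ
  choices S r s = (α S C r) ℕ.* (β S C s)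

  ∑-fresh-∷ : ∀ n S (Z : Vec (Fin k) (suc n) → Carrier) →
              ∑ (allVecs k (suc n)) (λ v → χ (fresh S v) * Z v) ≈
              ∑ (List.allFin k) (λ i → χ (not (S i)) * ∑ (allVecs k n) (λ v → χ (fresh (S ⊕ i) v) * Z (i ∷ v)))
  ∑-fresh-∷ n S Z = trans (∑-allVecs-suc k n _) (∑-cong (List.allFin k) λ i →
    trans (∑-cong (allVecs k n) (λ v → trans (*-congʳ (χ-∧ (not (S i)) _)) (*-assoc _ _ _))) (∑-*ˡ (allVecs k n) _ _))

  α-⊕ : ∀ S i → S i ≡ false → ∀ {p} → P i ≡ p → α (S ⊕ i) ℕ.+ boolToℕ p ≡ α S
  α-⊕ S i Si≡false ≡.refl = card-⊕ P S i Si≡false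

  β-⊕ : ∀ S i → S i ≡ false → ∀ {p} → P i ≡ p → β (S ⊕ i) ℕ.+ boolToℕ (not p) ≡ β S
  β-⊕ S i Si≡false ≡.refl = card-⊕ (not ∘ P) S i Si≡false

  α+β-⊕ : ∀ S i → S i ≡ false → ℕ.suc (α (S ⊕ i) ℕ.+ β (S ⊕ i)) ≡ α S ℕ.+ β S
  α+β-⊕ S i Si≡false = ≡.trans (shuffle (P i) (α (S ⊕ i)) (β (S ⊕ i)))
                               (≡.cong₂ ℕ._+_ (α-⊕ S i Si≡false ≡.refl) (β-⊕ S i Si≡false ≡.refl))
    where
    shuffle : ∀ p a b → ℕ.suc (a ℕ.+ b) ≡ (a ℕ.+ boolToℕ p) ℕ.+ (b ℕ.+ boolToℕ (not p))
    shuffle true  = solve-∀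
    shuffle false = solve-∀

  α+β≡card-not : ∀ S → α S ℕ.+ β S ≡ card (not ∘ S)
  α+β≡card-not S = card-+ λ j → split (P j) (S j)
    where
    split : ∀ p s → boolToℕ (p ∧ not s) ℕ.+ boolToℕ (not p ∧ not s) ≡ boolToℕ (not s)
    split true  s     = ℕₚ.+-identityʳ _
    split false true  = ≡.refl
    split false false = ≡.refl

  Count-zero : ∀ n S → α S ℕ.+ β S ≡ n → Count n S 0 0 0 ≈ cast (n !)
  Count-zero zero    S _        = +-congʳ (trans (*-identityˡ _) (*-identityˡ _))
  Count-zero (suc n) S α+β≡1+n = begin
    Count (suc n) S 0 0 0
      ≈⟨ ∑-fresh-∷ n S _ ⟩
    ∑ (List.allFin k) (λ i → χ (not (S i)) * Count n (S ⊕ i) 0 0 0)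
      ≈⟨ ∑-χ*const (not ∘ S) _ (cast (n !)) (λ i ¬Si → Count-zero n (S ⊕ i)
           (ℕₚ.suc-injective (≡.trans (α+β-⊕ S i (Boolₚ.not-injective ¬Si)) α+β≡1+n))) ⟩
    cast (card (not ∘ S)) * cast (n !)
      ≈⟨ castR-* (card (not ∘ S)) (n !) ⟨
    cast (card (not ∘ S) ℕ.* n !)
      ≈⟨ castR-cong (≡.cong (ℕ._* n !) (≡.trans (≡.sym (α+β≡card-not S)) α+β≡1+n)) ⟩
    cast (suc n !) ∎

  module _ (n b : ℕ)
           (IH : ∀ S r s → r ℕ.+ s ≡ b → α S ℕ.+ β S ≡ n → Count n S b r s ≈ cast (orderings n b ℕ.* choices S r s))
           where

    ∑-zero-terms : ∀ T (Z : Vec (Fin k) n → Carrier) → ∑ (allVecs k n) (λ v → χ (fresh T v) * (0# * Z v)) ≈ 0#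
    ∑-zero-terms T Z = trans (∑-cong (allVecs k n) (λ v → trans (*-congˡ (zeroˡ _)) (zeroʳ _))) (∑-0 (allVecs k n))

    cast-O*0 : cast (orderings n b ℕ.* 0) ≈ 0#
    cast-O*0 = castR-cong (ℕₚ.*-zeroʳ (orderings n b))

    first-inside : ∀ S i r s → S i ≡ false → P i ≡ true → ℕ.suc b ≡ r ℕ.+ s → α S ℕ.+ β S ≡ ℕ.suc n →
              ∑ (allVecs k n) (λ v → χ (fresh (S ⊕ i) v) * (δ (ℕ.suc (hits P b v)) r * δ (hits (not ∘ P) b v) s))
              ≈ cast (orderings n b ℕ.* inStep (α S) (β S) r s)
    first-inside S i zero    s _ _ _ _ = trans (∑-zero-terms (S ⊕ i) _) (sym cast-O*0)
    first-inside S i (suc r) s Si≡false Pi≡true 1+b≡ α+β≡ = begin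
      Count n (S ⊕ i) b r s
        ≈⟨ IH (S ⊕ i) r s (ℕₚ.suc-injective (≡.sym 1+b≡)) (ℕₚ.suc-injective (≡.trans (α+β-⊕ S i Si≡false) α+β≡)) ⟩
      cast (orderings n b ℕ.* choices (S ⊕ i) r s)
        ≈⟨ castR-cong (≡.cong₂ (λ x y → orderings n b ℕ.* ((x C r) ℕ.* (y C s))) α-drops β-stays) ⟩
      cast (orderings n b ℕ.* inStep (α S) (β S) (suc r) s) ∎
      where
      α-drops : α (S ⊕ i) ≡ α S ∸ 1
      α-drops = ≡.trans (≡.sym (ℕₚ.m+n∸n≡m _ 1)) (≡.cong (_∸ 1) (α-⊕ S i Si≡false Pi≡true))
      β-stays : β (S ⊕ i) ≡ β S
      β-stays = ≡.trans (≡.sym (ℕₚ.+-identityʳ _)) (β-⊕ S i Si≡false Pi≡true)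

    first-outside : ∀ S i r s → S i ≡ false → P i ≡ false → ℕ.suc b ≡ r ℕ.+ s → α S ℕ.+ β S ≡ ℕ.suc n →
               ∑ (allVecs k n) (λ v → χ (fresh (S ⊕ i) v) * (δ (hits P b v) r * δ (ℕ.suc (hits (not ∘ P) b v)) s))
               ≈ cast (orderings n b ℕ.* outStep (α S) (β S) r s)
    first-outside S i r zero    _ _ _ _ =
      trans (∑-cong (allVecs k n) (λ v → *-congˡ (*-comm _ _))) (trans (∑-zero-terms (S ⊕ i) _) (sym cast-O*0))
    first-outside S i r (suc s) Si≡false Pi≡false 1+b≡ α+β≡ = begin
      Count n (S ⊕ i) b r s
        ≈⟨ IH (S ⊕ i) r s (≡.sym (ℕₚ.suc-injective (≡.trans 1+b≡ (ℕₚ.+-suc r s))))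
                          (ℕₚ.suc-injective (≡.trans (α+β-⊕ S i Si≡false) α+β≡)) ⟩
      cast (orderings n b ℕ.* choices (S ⊕ i) r s)
        ≈⟨ castR-cong (≡.cong₂ (λ x y → orderings n b ℕ.* ((x C r) ℕ.* (y C s))) α-stays β-drops) ⟩
      cast (orderings n b ℕ.* outStep (α S) (β S) r (suc s)) ∎
      where
      α-stays : α (S ⊕ i) ≡ α S
      α-stays = ≡.trans (≡.sym (ℕₚ.+-identityʳ _)) (α-⊕ S i Si≡false Pi≡false)
      β-drops : β (S ⊕ i) ≡ β S ∸ 1
      β-drops = ≡.trans (≡.sym (ℕₚ.m+n∸n≡m _ 1)) (≡.cong (_∸ 1) (β-⊕ S i Si≡false Pi≡false))

    first-entry : ∀ S r s → ℕ.suc b ≡ r ℕ.+ s → α S ℕ.+ β S ≡ ℕ.suc n → ∀ i →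
           χ (not (S i)) * ∑ (allVecs k n) (λ v → χ (fresh (S ⊕ i) v) *
             (δ (boolToℕ (P i) ℕ.+ hits P b v) r * δ (boolToℕ (not (P i)) ℕ.+ hits (not ∘ P) b v) s))
           ≈ χ (P i ∧ not (S i)) * cast (orderings n b ℕ.* inStep (α S) (β S) r s)
             + χ (not (P i) ∧ not (S i)) * cast (orderings n b ℕ.* outStep (α S) (β S) r s)
    first-entry S r s 1+b≡ α+β≡ i with S i in Si≡ | P i in Pi≡
    ... | true  | true  = trans (zeroˡ _) (sym (trans (+-cong (zeroˡ _) (zeroˡ _)) (+-identityʳ 0#)))
    ... | true  | false = trans (zeroˡ _) (sym (trans (+-cong (zeroˡ _) (zeroˡ _)) (+-identityʳ 0#)))
    ... | false | true  = trans (*-identityˡ _) (trans (first-inside S i r s Si≡ Pi≡ 1+b≡ α+β≡)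
                                (sym (trans (+-cong (*-identityˡ _) (zeroˡ _)) (+-identityʳ _))))
    ... | false | false = trans (*-identityˡ _) (trans (first-outside S i r s Si≡ Pi≡ 1+b≡ α+β≡)
                                (sym (trans (+-cong (zeroˡ _) (*-identityˡ _)) (+-identityˡ _))))

    Count-step : ∀ S r s → r ℕ.+ s ≡ ℕ.suc b → α S ℕ.+ β S ≡ ℕ.suc n →
                 Count (suc n) S (suc b) r s ≈ cast (orderings (suc n) (suc b) ℕ.* choices S r s)
    Count-step S r s r+s≡ α+β≡ = begin
      Count (suc n) S (suc b) r s
        ≈⟨ ∑-fresh-∷ n S _ ⟩
      ∑ (List.allFin k) (λ i → χ (not (S i)) * ∑ (allVecs k n) (λ v → χ (fresh (S ⊕ i) v) *
          (δ (boolToℕ (P i) ℕ.+ hits P b v) r * δ (boolToℕ (not (P i)) ℕ.+ hits (not ∘ P) b v) s)))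
        ≈⟨ ∑-cong (List.allFin k) (first-entry S r s (≡.sym r+s≡) α+β≡) ⟩
      ∑ (List.allFin k) (λ i → χ (P i ∧ not (S i)) * X + χ (not (P i) ∧ not (S i)) * Y)
        ≈⟨ ∑-+ (List.allFin k) _ _ ⟩
      ∑ (List.allFin k) (λ i → χ (P i ∧ not (S i)) * X) + ∑ (List.allFin k) (λ i → χ (not (P i) ∧ not (S i)) * Y)
        ≈⟨ +-cong (∑-χ*const (λ i → P i ∧ not (S i)) _ X (λ _ _ → refl))
                  (∑-χ*const (λ i → not (P i) ∧ not (S i)) _ Y (λ _ _ → refl)) ⟩
      cast (α S) * X + cast (β S) * Y
        ≈⟨ +-cong (castR-* (α S) _) (castR-* (β S) _) ⟨
      cast (α S ℕ.* (orderings n b ℕ.* inStep (α S) (β S) r s)) + cast (β S ℕ.* (orderings n b ℕ.* outStep (α S) (β S) r s))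
        ≈⟨ castR-+ (α S ℕ.* (orderings n b ℕ.* inStep (α S) (β S) r s)) (β S ℕ.* (orderings n b ℕ.* outStep (α S) (β S) r s)) ⟨
      cast (α S ℕ.* (orderings n b ℕ.* inStep (α S) (β S) r s) ℕ.+ β S ℕ.* (orderings n b ℕ.* outStep (α S) (β S) r s))
        ≈⟨ castR-cong (step-identity (α S) (β S) r s b (orderings n b) r+s≡) ⟩
      cast (ℕ.suc b ℕ.* orderings n b ℕ.* choices S r s)
        ≈⟨ castR-cong (≡.cong (ℕ._* choices S r s) (ℕₚ.*-assoc (ℕ.suc b) (b !) _)) ⟨
      cast (orderings (suc n) (suc b) ℕ.* choices S r s) ∎
      where
      X = cast (orderings n b ℕ.* inStep (α S) (β S) r s)
      Y = cast (orderings n b ℕ.* outStep (α S) (β S) r s)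

  -- Choose which r of the α available P-elements and which s of the β others fill the first
  -- b places, then order the first b places and the remaining n − b.
  Count-formula : ∀ n S b r s → b ≤ n → r ℕ.+ s ≡ b → α S ℕ.+ β S ≡ n →
                  Count n S b r s ≈ cast (orderings n b ℕ.* choices S r s)
  Count-formula n       S zero    zero zero _ _ α+β≡n =
    trans (Count-zero n S α+β≡n) (castR-cong (≡.sym (≡.trans (ℕₚ.*-identityʳ _) (ℕₚ.*-identityˡ (n !)))))
  Count-formula (suc n) S (suc b) r s (s≤s b≤n) r+s≡ α+β≡ =
    Count-step n b (λ S′ r′ s′ → Count-formula n S′ b r′ s′ b≤n) S r s r+s≡ α+β≡

  ∅ : Fin k → Bool
  ∅ _ = false

  α-∅ : α ∅ ≡ card P
  α-∅ = card-cong (λ j → Boolₚ.∧-identityʳ (P j))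

  β-∅ : β ∅ ≡ k ∸ card P
  β-∅ = ≡.trans (card-cong (λ j → Boolₚ.∧-identityʳ (not (P j)))) (card-not P)

  α+β-∅ : α ∅ ℕ.+ β ∅ ≡ k
  α+β-∅ = ≡.trans (α+β≡card-not ∅) (card-true k)

  ∑-fresh-by-hits : ∀ b → b ≤ k → (L : List ℕ) → Unique L → (∀ {l} → l ∈ L → l ≤ b) → (g : ℕ → Carrier) →
                    (∀ v → fresh ∅ v ≡ true → hits P b v ∈ L) →
                    ∑ (allVecs k k) (λ v → χ (fresh ∅ v) * g (hits P b v)) ≈
                    ∑ L (λ l → cast (orderings k b ℕ.* choices ∅ l (b ∸ l)) * g l)
  ∑-fresh-by-hits b b≤k L L! L≤b g hits∈L = begin
    ∑ (allVecs k k) (λ v → χ (fresh ∅ v) * g (hits P b v))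
      ≈⟨ ∑-cong (allVecs k k) (λ v → χ-*-cong (fresh ∅ v) (λ fresh≡true → sym (pick v fresh≡true))) ⟩
    ∑ (allVecs k k) (λ v → χ (fresh ∅ v) * ∑ L (λ l → term v l * g l))
      ≈⟨ ∑-cong (allVecs k k) (λ v → trans (sym (∑-*ˡ L _ _)) (∑-cong L (λ l → sym (*-assoc _ _ _)))) ⟩
    ∑ (allVecs k k) (λ v → ∑ L (λ l → χ (fresh ∅ v) * term v l * g l))
      ≈⟨ ∑-swap (allVecs k k) L _ ⟩
    ∑ L (λ l → ∑ (allVecs k k) (λ v → χ (fresh ∅ v) * term v l * g l))
      ≈⟨ ∑-cong L (λ l → ∑-*ʳ (allVecs k k) (g l) _) ⟩
    ∑ L (λ l → Count k ∅ b l (b ∸ l) * g l)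
      ≈⟨ ∑-cong-∈ L (λ {l} l∈L → *-congʳ (Count-formula k ∅ b l (b ∸ l) b≤k (ℕₚ.m+[n∸m]≡n (L≤b l∈L)) α+β-∅)) ⟩
    ∑ L (λ l → cast (orderings k b ℕ.* choices ∅ l (b ∸ l)) * g l) ∎
    where
    term : Vec (Fin k) k → ℕ → Carrier
    term v l = δ (hits P b v) l * δ (hits (not ∘ P) b v) (b ∸ l)
    pick : ∀ v → fresh ∅ v ≡ true → ∑ L (λ l → term v l * g l) ≈ g (hits P b v)
    pick v fresh≡true = begin
      ∑ L (λ l → term v l * g l)
        ≈⟨ ∑-cong L (λ l → trans (*-assoc _ _ _) (*-congʳ (reflexive (δ-sym (hits P b v) l)))) ⟩
      ∑ L (λ l → δ l (hits P b v) * (δ (hits (not ∘ P) b v) (b ∸ l) * g l))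
        ≈⟨ ∑-pick ℕₚ._≟_ L! (hits∈L v fresh≡true) _ ⟩
      δ (hits (not ∘ P) b v) (b ∸ hits P b v) * g (hits P b v)
        ≈⟨ *-congʳ (trans (reflexive (≡.cong (λ t → δ t (b ∸ hits P b v)) misses)) (δ-refl (b ∸ hits P b v))) ⟩
      1# * g (hits P b v)
        ≈⟨ *-identityˡ _ ⟩
      g (hits P b v) ∎
      where
      misses : hits (not ∘ P) b v ≡ b ∸ hits P b v
      misses = ≡.trans (≡.sym (ℕₚ.m+n∸m≡n (hits P b v) _)) (≡.cong (_∸ hits P b v) (hits-+ P b v b≤k))

  ∑-allPerms : ∀ (f : (Fin k → Fin k) → Carrier) → ∑ (allPerms k) f ≈ ∑ (allVecs k k) (λ v → χ (fresh ∅ v) * f (lookup v))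
  ∑-allPerms f = begin
    ∑ (allPerms k) f
      ≡⟨ ∑-map lookup (filter (λ v → UniqueDec.unique? Finₚ._≟_ (toList v)) (allVecs k k)) f ⟩
    ∑ (filter (λ v → UniqueDec.unique? Finₚ._≟_ (toList v)) (allVecs k k)) (f ∘ lookup)
      ≈⟨ ∑-filter _ (allVecs k k) _ ⟩
    ∑ (allVecs k k) (λ v → χ (distinct v) * f (lookup v))
      ≈⟨ ∑-cong (allVecs k k) (λ v → *-congʳ (reflexive (≡.cong χ (≡.sym (fresh-∅≡distinct v))))) ⟩
    ∑ (allVecs k k) (λ v → χ (fresh ∅ v) * f (lookup v)) ∎

module Products {c ℓ} (F : CharZeroField c ℓ) (k : ℕ) where
  open CharZeroField F hiding (zero)
  open Coinv F k
  open FiniteSums ring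
  open Coinvariants F k
  open import Relation.Binary.Reasoning.Setoid setoid
  open import Algebra.Solver.Ring.NaturalCoefficients.Default commutativeSemiring using (solve; _:*_; _:=_)

  recip-*ʳ : ∀ p q .{{_ : NonZero q}} → recip (p ℕ.* q) * cast q ≈ recip p
  recip-*ʳ zero    q                 = zeroˡ _
  recip-*ʳ (suc p) q@(suc q-1) = begin
    R * cast q                              ≈⟨ *-identityʳ _ ⟨
    R * cast q * 1#                         ≈⟨ *-congˡ (inverse (cast (suc p)) (charZero p)) ⟨
    R * cast q * (cast (suc p) * Rp)        ≈⟨ solve 4 (λ r y x s → r :* y :* (x :* s) := (x :* y :* r) :* s) refl R (cast q) (cast (suc p)) Rp ⟩
    (cast (suc p) * cast q * R) * Rp        ≈⟨ *-congʳ (*-congʳ (castR-* (suc p) q)) ⟨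
    (cast (suc p ℕ.* q) * R) * Rp           ≈⟨ *-congʳ (inverse (cast (suc p ℕ.* q)) (charZero (q-1 ℕ.+ p ℕ.* q))) ⟩
    1# * Rp                                 ≈⟨ *-identityˡ _ ⟩
    Rp                                      ∎
    where
    R  = recip (suc p ℕ.* q)
    Rp = recip (suc p)

  module _ (a b : ℕ) (a≤k : a ≤ k) (b≤k : b ≤ k) where

    A : Fin k → Bool
    A = below a

    ∣seg-a⊙image∣ : ∀ (_∙_ : Bool → Bool → Bool) (v : Vec (Fin k) k) →
                    ∣ zipWith _∙_ (seg a) (image (lookup v) (seg b)) ∣ ≡ card (λ j → A j ∙ prefix b v j)
    ∣seg-a⊙image∣ _∙_ v = ≡.trans (∣p∣≡card-lookup (zipWith _∙_ (seg a) X)) (card-cong λ j →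
      ≡.trans (Vecₚ.lookup-zipWith _∙_ j (seg a) X) (≡.cong₂ _∙_ (Vecₚ.lookup∘tabulate A j)
        (≡.trans (lookup-image (lookup v) (seg b) j)
                 (anyFin-cong λ i → ≡.cong (_∧ ⌊ lookup v i Finₚ.≟ j ⌋) (Vecₚ.lookup∘tabulate (below b) i)))))
      where X = image (lookup v) (seg b)

    recip-k!*orderings : recip (k !) * cast (b ! ℕ.* (k ∸ b) !) ≈ recip (k C b)
    recip-k!*orderings = trans (*-congʳ (reflexive (≡.cong recip (≡.sym (nCk*[k!*[n∸k]!]≡n! b≤k)))))
                               (recip-*ʳ (k C b) _ {{ℕₚ._!*_!≢0 b (k ∸ b)}})

    rescale-coefficients : ∀ (L : List ℕ) (x y : ℕ → ℕ) (g : ℕ → Carrier) → (∀ {l} → l ∈ L → x l ≡ y l) →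
                recip (k !) * ∑ L (λ l → cast (b ! ℕ.* (k ∸ b) ! ℕ.* x l) * g l) ≈ recip (k C b) * ∑ L (λ l → cast (y l) * g l)
    rescale-coefficients L x y g x≡y = begin
      recip (k !) * ∑ L (λ l → cast (O ℕ.* x l) * g l)    ≈⟨ ∑-*ˡ L _ _ ⟨
      ∑ L (λ l → recip (k !) * (cast (O ℕ.* x l) * g l))  ≈⟨ ∑-cong-∈ L regroup ⟩
      ∑ L (λ l → recip (k C b) * (cast (y l) * g l))      ≈⟨ ∑-*ˡ L _ _ ⟩
      recip (k C b) * ∑ L (λ l → cast (y l) * g l)        ∎
      where
      O = b ! ℕ.* (k ∸ b) !
      regroup : ∀ {l} → l ∈ L → recip (k !) * (cast (O ℕ.* x l) * g l) ≈ recip (k C b) * (cast (y l) * g l)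
      regroup {l} l∈L = begin
        recip (k !) * (cast (O ℕ.* x l) * g l)      ≈⟨ *-congˡ (*-congʳ (castR-* O (x l))) ⟩
        recip (k !) * (cast O * cast (x l) * g l)   ≈⟨ solve 4 (λ r o x g → r :* (o :* x :* g) := (r :* o) :* (x :* g)) refl _ _ _ _ ⟩
        (recip (k !) * cast O) * (cast (x l) * g l) ≈⟨ *-cong recip-k!*orderings (*-congʳ (castR-cong (x≡y l∈L))) ⟩
        recip (k C b) * (cast (y l) * g l)          ∎

    module _ (P : Fin k → Bool) where
      open Counting F k P

      levelSum-product : ∀ j _⊙_ (φ : ℕ → ℕ) (L : List ℕ) (coef : ℕ → ℕ) → Unique L → (∀ {l} → l ∈ L → l ≤ b) →
        (∀ v → fresh ∅ v ≡ true → hits P b v ∈ L × ∣ seg a ⊙ image (lookup v) (seg b) ∣ ≡ φ (hits P b v)) →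
        (∀ l → choices ∅ l (b ∸ l) ≡ coef l) →
        levelSum j (λ d → recip (k !) * ∑ (allPerms k) (λ σ → bilinear _⊙_ (hat a) (act σ (hat b)) d))
        ≈ recip (k C b) * ∑ L (λ l → cast (coef l) * δ (φ l) j)
      levelSum-product j _⊙_ φ L coef L! L≤b profile choices≡coef = begin
        levelSum j (λ d → recip (k !) * ∑ (allPerms k) (λ σ → bilinear _⊙_ (hat a) (act σ (hat b)) d))
          ≈⟨ levelSum-average j _⊙_ (seg a) (seg b) (recip (k !)) (allPerms k) ⟩
        recip (k !) * ∑ (allPerms k) (λ σ → δ ∣ seg a ⊙ image σ (seg b) ∣ j)
          ≈⟨ *-congˡ (∑-allPerms _) ⟩
        recip (k !) * ∑ (allVecs k k) (λ v → χ (fresh ∅ v) * δ ∣ seg a ⊙ image (lookup v) (seg b) ∣ j)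
          ≈⟨ *-congˡ (∑-cong (allVecs k k) λ v → χ-*-cong (fresh ∅ v) λ fresh≡true →
               reflexive (≡.cong (λ m → δ m j) (proj₂ (profile v fresh≡true)))) ⟩
        recip (k !) * ∑ (allVecs k k) (λ v → χ (fresh ∅ v) * δ (φ (hits P b v)) j)
          ≈⟨ *-congˡ (∑-fresh-by-hits b b≤k L L! L≤b (λ l → δ (φ l) j) (λ v → proj₁ ∘ profile v)) ⟩
        recip (k !) * ∑ L (λ l → cast (orderings k b ℕ.* choices ∅ l (b ∸ l)) * δ (φ l) j)
          ≈⟨ rescale-coefficients L _ _ _ (λ {l} _ → choices≡coef l) ⟩
        recip (k C b) * ∑ L (λ l → cast (coef l) * δ (φ l) j) ∎

    module Cup = Counting F k (not ∘ A)

    cupRange : List ℕ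
    cupRange = upTo (suc ((k ∸ a) ⊓ b))

    ∈cupRange⇒≤ : ∀ {l} → l ∈ cupRange → l ≤ k ∸ a × l ≤ b
    ∈cupRange⇒≤ l∈ with s≤s l≤ ← ∈-upTo⁻ l∈ = ℕₚ.≤-trans l≤ (ℕₚ.m⊓n≤m _ _) , ℕₚ.≤-trans l≤ (ℕₚ.m⊓n≤n _ _)

    cup-profile : ∀ v → fresh Cup.∅ v ≡ true →
                  hits (not ∘ A) b v ∈ cupRange × ∣ seg a ∪ image (lookup v) (seg b) ∣ ≡ a ℕ.+ hits (not ∘ A) b v
    cup-profile v fresh≡true = ∈-upTo⁺ (s≤s (ℕₚ.⊓-glb ≤k∸a ≤b)) , ∣cup∣
      where
      ∣cup∣ : ∣ seg a ∪ image (lookup v) (seg b) ∣ ≡ a ℕ.+ hits (not ∘ A) b v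
      ∣cup∣ = ≡.trans (∣seg-a⊙image∣ _∨_ v) (≡.trans (card-∨ A (prefix b v))
                (≡.cong₂ ℕ._+_ (card-below a a≤k) (card-prefix Cup.∅ (not ∘ A) b v fresh≡true)))
      ≤b : hits (not ∘ A) b v ≤ b
      ≤b = ≡.subst (hits (not ∘ A) b v ≤_) (hits-+ A b v b≤k) (ℕₚ.m≤n+m _ (hits A b v))
      ≤k∸a : hits (not ∘ A) b v ≤ k ∸ a
      ≤k∸a = ≡.subst (_≤ k ∸ a) (ℕₚ.m+n∸m≡n a _)
               (ℕₚ.∸-monoˡ-≤ a (≡.subst (_≤ k) ∣cup∣ (∣p∣≤n (seg a ∪ image (lookup v) (seg b)))))

    cup-choices : ∀ l → Cup.choices Cup.∅ l (b ∸ l) ≡ (a C (b ∸ l)) ℕ.* ((k ∸ a) C l)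
    cup-choices l = ≡.trans (≡.cong₂ (λ x y → (x C l) ℕ.* (y C (b ∸ l))) α≡k∸a β≡a) (ℕₚ.*-comm ((k ∸ a) C l) (a C (b ∸ l)))
      where
      card-¬A : card (not ∘ A) ≡ k ∸ a
      card-¬A = ≡.trans (card-not A) (≡.cong (k ∸_) (card-below a a≤k))
      α≡k∸a : Cup.α Cup.∅ ≡ k ∸ a
      α≡k∸a = ≡.trans Cup.α-∅ card-¬A
      β≡a : Cup.β Cup.∅ ≡ a
      β≡a = ≡.trans Cup.β-∅ (≡.trans (≡.cong (k ∸_) card-¬A) (ℕₚ.m∸[m∸n]≡n a≤k))

    levelSum-cupC : ∀ j → levelSum j (cupC (hat a) (hat b)) ≈ levelSum j (rhsCup a b)
    levelSum-cupC j = begin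
      levelSum j (cupC (hat a) (hat b))
        ≈⟨ levelSum-product (not ∘ A) j _∪_ (a ℕ.+_) cupRange _ (Uniqueₚ.upTo⁺ _) (proj₂ ∘ ∈cupRange⇒≤) cup-profile cup-choices ⟩
      recip (k C b) * ∑ cupRange (λ l → cast ((a C (b ∸ l)) ℕ.* ((k ∸ a) C l)) * δ (a ℕ.+ l) j)
        ≈⟨ levelSum-combination j _ cupRange _ (a ℕ.+_) a+l≤k ⟨
      levelSum j (rhsCup a b) ∎
      where
      a+l≤k : ∀ {l} → l ∈ cupRange → a ℕ.+ l ≤ k
      a+l≤k l∈ = ≡.subst (a ℕ.+ _ ≤_) (ℕₚ.m+[n∸m]≡n a≤k) (ℕₚ.+-monoʳ-≤ a (proj₁ (∈cupRange⇒≤ l∈)))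

    module Cap = Counting F k A

    capRange : List ℕ
    capRange = upTo (suc (a ⊓ b))

    ∈capRange⇒≤ : ∀ {l} → l ∈ capRange → l ≤ a × l ≤ b
    ∈capRange⇒≤ l∈ with s≤s l≤ ← ∈-upTo⁻ l∈ = ℕₚ.≤-trans l≤ (ℕₚ.m⊓n≤m _ _) , ℕₚ.≤-trans l≤ (ℕₚ.m⊓n≤n _ _)

    cap-profile : ∀ v → fresh Cap.∅ v ≡ true →
                  hits A b v ∈ capRange × ∣ seg a ∩ image (lookup v) (seg b) ∣ ≡ hits A b v
    cap-profile v fresh≡true = ∈-upTo⁺ (s≤s (ℕₚ.⊓-glb ≤a ≤b)) , ∣cap∣
      where
      ∣cap∣ : ∣ seg a ∩ image (lookup v) (seg b) ∣ ≡ hits A b v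
      ∣cap∣ = ≡.trans (∣seg-a⊙image∣ _∧_ v) (card-prefix Cap.∅ A b v fresh≡true)
      ≤b : hits A b v ≤ b
      ≤b = ≡.subst (hits A b v ≤_) (hits-+ A b v b≤k) (ℕₚ.m≤m+n _ (hits (not ∘ A) b v))
      ≤a : hits A b v ≤ a
      ≤a = ≡.subst₂ _≤_ ∣cap∣ (∣seg∣ a≤k) (∣p∩q∣≤∣p∣ (seg a) (image (lookup v) (seg b)))

    cap-choices : ∀ l → Cap.choices Cap.∅ l (b ∸ l) ≡ (a C l) ℕ.* ((k ∸ a) C (b ∸ l))
    cap-choices l = ≡.cong₂ (λ x y → (x C l) ℕ.* (y C (b ∸ l))) α≡a β≡k∸a
      where
      α≡a : Cap.α Cap.∅ ≡ a
      α≡a = ≡.trans Cap.α-∅ (card-below a a≤k)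
      β≡k∸a : Cap.β Cap.∅ ≡ k ∸ a
      β≡k∸a = ≡.trans Cap.β-∅ (≡.cong (k ∸_) (card-below a a≤k))

    levelSum-capC : ∀ j → levelSum j (capC (hat a) (hat b)) ≈ levelSum j (rhsCap a b)
    levelSum-capC j = begin
      levelSum j (capC (hat a) (hat b))
        ≈⟨ levelSum-product A j _∩_ (λ l → l) capRange _ (Uniqueₚ.upTo⁺ _) (proj₂ ∘ ∈capRange⇒≤) cap-profile cap-choices ⟩
      recip (k C b) * ∑ capRange (λ l → cast ((a C l) ℕ.* ((k ∸ a) C (b ∸ l))) * δ l j)
        ≈⟨ levelSum-combination j _ capRange _ (λ l → l) (λ l∈ → ℕₚ.≤-trans (proj₁ (∈capRange⇒≤ l∈)) a≤k) ⟨
      levelSum j (rhsCap a b) ∎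

    levelSum-complV : ∀ j → levelSum j (complV (hat a)) ≈ levelSum j (hat (k ∸ a))
    levelSum-complV j = begin
      levelSum j (complV (hat a))    ≈⟨ levelSum-cong j (complV-basis (seg a)) ⟩
      levelSum j (basis (∁ (seg a))) ≈⟨ levelSum-basis j (∁ (seg a)) ⟩
      δ (∣ ∁ (seg a) ∣) j            ≡⟨ ≡.cong (λ m → δ m j) ∣∁seg-a∣ ⟩
      δ (∣ seg (k ∸ a) ∣) j        ≈⟨ levelSum-basis j (seg (k ∸ a)) ⟨
      levelSum j (hat (k ∸ a))     ∎
      where
      ∣∁seg-a∣ : ∣ ∁ (seg a) ∣ ≡ ∣ seg (k ∸ a) ∣
      ∣∁seg-a∣ = ≡.trans (∣∁p∣≡n∸∣p∣ (seg a))
                 (≡.trans (≡.cong (k ∸_) (∣seg∣ a≤k)) (≡.sym (∣seg∣ (ℕₚ.m∸n≤m k a))))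

theorem3p4 : ∀ {c ℓ : Level} (F : CharZeroField c ℓ) (k : ℕ) → 1 ≤ k →
    ∀ (a b : ℕ) → a ≤ k → b ≤ k →
      let open Coinv F k in
      (cupC (hat a) (hat b) ∼ rhsCup a b)
      × (capC (hat a) (hat b) ∼ rhsCap a b)
      × (complV (hat a) ∼ hat (k ∸ a))
theorem3p4 F k _ a b a≤k b≤k =
    levelSums-determine-class _ _ (levelSum-cupC a b a≤k b≤k)
  , levelSums-determine-class _ _ (levelSum-capC a b a≤k b≤k)
  , levelSums-determine-class _ _ (levelSum-complV a b a≤k b≤k)
  where
  open Coinvariants F k
  open Products F k
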